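{- Let $G=(V,E)$ be an $r$-root-connected digraph. Then the degree of the parking function enumerator of $G$ rooted at $r$ equals $|E|-|V|+1-\mathrm{minfas}(G,r)$. Equivalently, in the greedoid polynomial of the branching greedoid of $G$ rooted at $r$, the coefficients of $x^0,\dots,x^{\mathrm{minfas}(G,r)-1}$ are zero and the coefficient of $x^{\mathrm{minfas}(G,r)}$ is nonzero.
   Context: A digraph is $r$-root-connected if every vertex is reachable from $r$ by a directed path. $F\subseteq E$ is an $r$-connected feedback arc set if the digraph $(V,E-F)$ is $r$-root-connected and acyclic; $\mathrm{minfas}(G,r)$ is the minimum cardinality of such a set. A parking function rooted at $r$ is $p\in\mathbb Z_{\ge0}^{V-r}$ such that every nonempty $S\subseteq V-r$ contains $u$ with $p(u)<d(V-S,u)$, the number of edges from $V-S$ to $u$; the parking function enumerator is $\sum_p x^{\sum_v p(v)}$. A greedoid on finite $E$ is a family $\mathcal F$ of subsets with $\emptyset\in\mathcal F$; every nonempty $X\in\mathcal F$ has $x\in X$ with $X-x\in\mathcal F$; if $X,Y\in\mathcal F$, $|X|=|Y|+1$, then $Y\cup x\in\mathcal F$ for some $x\in X-Y$; bases are maximal members. The branching greedoid of $G$ rooted at $r$ consists of edge sets forming an arborescence rooted at $r$ (a tree containing $r$ with every of its vertices reachable from $r$ by a directed path, plus isolated vertices). For a basis $B$, a word listing its elements is feasible if every prefix lies in $\mathcal F$. Fix an ordering of $E$; $e\notin B$ is externally active for $B$ if for every $f\in B$ with $B\cup e-f\in\mathcal F$ the lexicographically minimal feasible word of $B$ is lexicographically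 smaller than that of $B-f\cup e$. With $e(B)$ the number of externally active elements, the greedoid polynomial is $\sum_B t^{e(B)}$ (independent of the ordering). -}

module Defs where

open import Data.Nat using (ℕ; zero; suc; _+_; _<_; _≤_)
open import Data.Fin using (Fin; _≟_) renaming (_<_ to _<ᶠ_)
open import Data.Fin.Subset using (Subset; _∈_; _∉_; _⊆_; _∪_; _-_; ⁅_⁆; ⊥; ⊤; ∁; ∣_∣; Nonempty)
open import Data.Fin.Subset.Properties using (_∈?_)
open import Data.List using (List; []; _∷_; length; filter; foldr; take; map)
open import Data.Nat.ListAction using (sum)
open import Data.List.Base using (allFin)
open import Data.List.Relation.Unary.Unique.Propositional using (Unique)
import Data.List.Membership.Propositional as LM
open import Data.Product using (Σ; ∃; _×_; _,_)
open import Data.Sum using (_⊎_)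
open import Relation.Nullary using (¬_; ¬?)
open import Relation.Nullary.Decidable using (_×-dec_)
open import Relation.Binary.PropositionalEquality using (_≡_; _≢_)
open import Function.Bundles using (_⇔_)

-- The ordering of E used for lexicographic comparisons is the order of Fin m.
record Digraph : Set where
  field
    n   : ℕ
    m   : ℕ
    src : Fin m → Fin n
    tgt : Fin m → Fin n
open Digraph public

module _ (G : Digraph) where

  V = Fin (n G)
  E = Fin (m G)

  data Reach (A : Subset (m G)) : V → V → Set where
    here : ∀ {u} → Reach A u u
    step : ∀ {u w} (e : E) → e ∈ A → src G e ≡ u → Reach A (tgt G e) w → Reach A u w

  RootConnected : Subset (m G) → V → Set
  RootConnected A r = ∀ v → Reach A r v

  -- (V, A) is acyclic: no directed cycle (a directed cycle exists iff some
  -- edge e ∈ A has its source reachable from its target within A).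
  Acyclic : Subset (m G) → Set
  Acyclic A = ¬ (Σ E λ e → e ∈ A × Reach A (tgt G e) (src G e))

  IsConnFAS : V → Subset (m G) → Set
  IsConnFAS r F = RootConnected (∁ F) r × Acyclic (∁ F)

  MinFAS : V → ℕ → Set
  MinFAS r k = (Σ (Subset (m G)) λ F → IsConnFAS r F × ∣ F ∣ ≡ k)
             × (∀ F → IsConnFAS r F → k ≤ ∣ F ∣)

  -- d(V - S, u): number of edges from V - S to u.
  dIn : Subset (n G) → V → ℕ
  dIn S u = length (filter (λ e → ¬? (src G e ∈? S) ×-dec (tgt G e ≟ u)) (allFin (m G)))

  -- Parking functions rooted at r, represented as p : V → ℕ with p r ≡ 0
  -- (i.e. p restricted to V - r).
  IsParking : V → (V → ℕ) → Set
  IsParking r p = p r ≡ 0 ×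
    (∀ (S : Subset (n G)) → Nonempty S → r ∉ S → Σ V λ u → u ∈ S × p u < dIn S u)

  weight : (V → ℕ) → ℕ
  weight p = sum (map p (allFin (n G)))

  -- deg of the parking function enumerator  Σ_p x^{Σ_v p(v)}  equals d:
  -- some parking function has weight d and none has larger weight
  -- (all coefficients are nonnegative counts, so this is the degree).
  ParkingDegree : V → ℕ → Set
  ParkingDegree r d = (Σ (V → ℕ) λ p → IsParking r p × weight p ≡ d)
                    × (∀ p → IsParking r p → weight p ≤ d)

  data UWalk (X : Subset (m G)) : V → V → List E → Set where
    nil  : ∀ {u} → UWalk X u u []
    cons : ∀ {u w es} (e : E) → e ∈ X →
           (src G e ≡ u × UWalk X (tgt G e) w es) ⊎ (tgt G e ≡ u × UWalk X (src G e) w es) →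
           UWalk X u w (e ∷ es)

  HasUCycle : Subset (m G) → Set
  HasUCycle X = Σ V λ u → Σ E λ e → Σ (List E) λ es →
                Unique (e ∷ es) × UWalk X u u (e ∷ es)

  -- X is feasible in the branching greedoid rooted at r: the edges of X form a
  -- tree containing r (acyclic as an undirected graph) in which every vertex
  -- (r and the endpoints of the edges of X) is reachable from r by a directed
  -- path in X.
  Feasible : V → Subset (m G) → Set
  Feasible r X = (∀ e → e ∈ X → Reach X r (src G e) × Reach X r (tgt G e))
               × ¬ HasUCycle X

  IsBasis : V → Subset (m G) → Set
  IsBasis r B = Feasible r B × (∀ X → Feasible r X → B ⊆ X → X ⊆ B)

  toSet : List E → Subset (m G)
  toSet = foldr (λ e S → S ∪ ⁅ e ⁆) ⊥

  FeasibleWord : V → Subset (m G) → List E → Set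
  FeasibleWord r B w = Unique w × (∀ e → e ∈ B ⇔ e LM.∈ w)
                     × (∀ i → Feasible r (toSet (take i w)))

  data _<lex_ : List E → List E → Set where
    []<∷ : ∀ {y ys} → [] <lex (y ∷ ys)
    head< : ∀ {x y xs ys} → x <ᶠ y → (x ∷ xs) <lex (y ∷ ys)
    tail< : ∀ {x xs ys} → xs <lex ys → (x ∷ xs) <lex (x ∷ ys)

  LexMinWord : V → Subset (m G) → List E → Set
  LexMinWord r B w = FeasibleWord r B w ×
                     (∀ w' → FeasibleWord r B w' → w ≡ w' ⊎ w <lex w')

  ExtActive : V → Subset (m G) → E → Set
  ExtActive r B e = e ∉ B ×
    (∀ f → f ∈ B → Feasible r ((B - f) ∪ ⁅ e ⁆) →
       ∀ w w' → LexMinWord r B w → LexMinWord r ((B - f) ∪ ⁅ e ⁆) w' → w <lex w')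

  ExtActivity : V → Subset (m G) → ℕ → Set
  ExtActivity r B k = Σ (Subset (m G)) λ A → (∀ e → e ∈ A ⇔ ExtActive r B e) × ∣ A ∣ ≡ k

  -- The coefficient of t^k in the greedoid polynomial Σ_B t^{e(B)} is the
  -- number of bases B with e(B) = k; it is nonzero iff such a basis exists.
  GreedoidCoeffNonzero : V → ℕ → Set
  GreedoidCoeffNonzero r k = Σ (Subset (m G)) λ B → IsBasis r B × ExtActivity r B k

module Submission where

-- Both halves rest on potentials t : V → ℕ: the edges along which t does not increase form an
-- r-connected feedback arc set as soon as every vertex other than r is entered by an increasing edge.
-- For an optimal F, p(v) = indeg_{G-F}(v) - 1 is a parking function (a set avoiding r has a source in
-- the acyclic G - F) of weight |E| - |F| - |V| + 1; conversely Dhar's burning algorithm turns a parking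
-- function p into a potential with more than p(v) increasing edges into each v ≠ r, bounding its weight.
-- A feasible set of the branching greedoid is an arborescence, its lexicographically minimal word is
-- the greedy one, and the time at which this word reaches a vertex is a potential whose
-- non-increasing edges are all externally active, so e(B) ≥ minfas. For an optimal F, appending the
-- edges of G - F in a suitably chosen order gives a basis whose externally active edges are exactly F.

open import Defs
open import Level using (Level)
open import Data.Bool using (if_then_else_)
open import Data.Empty using (⊥; ⊥-elim)
open import Data.Unit using (tt) renaming (⊤ to Unit)
open import Data.Nat using (ℕ; zero; suc; _+_; _∸_; _≤_; _<_; z≤n; s≤s; _≤?_; _<?_)
open import Data.Nat.Properties hiding (_≟_)
open import Algebra.Properties.CommutativeSemigroup +-commutativeSemigroup using (interchange)
open import Data.Nat.Induction using (<-wellFounded)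
open import Data.Nat.ListAction using (sum)
open import Data.Fin using (Fin; zero; suc; toℕ; _≟_) renaming (_≤_ to _≤ᶠ_; _<_ to _<ᶠ_)
import Data.Fin.Properties as Fin
open import Data.Fin.Subset using (Subset; _∈_; _∉_; _⊆_; _─_; _-_; ⁅_⁆; _∪_; ∁; ⊤; ∣_∣; Nonempty; inside; outside)
open import Data.Fin.Subset.Properties
  using (_∈?_; drop-there; x∈⁅x⁆; x∈⁅y⁆⇒x≡y; x∈p∪q⁻; x∈p∪q⁺; x∈p∧x≢y⇒x∈p-y; p─q⊆p; p⊆p∪q; x∈∁p⇒x∉p; x∉p⇒x∈∁p;
         x∈p⇒x∉∁p; x∉∁p⇒x∈p; ∉⊥; p⊆q⇒∣p∣≤∣q∣; p⊂q⇒∣p∣<∣q∣; ∣∁p∣≡n∸∣p∣; ∣p∣≤n)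
import Data.Vec.Base as Vec
open import Data.Vec.Properties using ([]=⇒lookup; lookup⇒[]=; lookup∘tabulate)
open import Data.List using (List; []; _∷_; _++_; [_]; length; take; drop; filter; map; allFin; tabulate)
open import Data.List.Properties
  using (filter-none; filter-some; map-tabulate; map-cong; length-tabulate; ∷-injective; ∷-injectiveˡ; ∷-injectiveʳ;
         ++-assoc; ++-identityʳ; ++-cancelˡ; ++-conicalʳ; take++drop≡id)
import Data.List.Membership.Propositional as L
open import Data.List.Membership.Propositional.Properties using (∈-++⁺ˡ; ∈-++⁺ʳ; ∈-++⁻; ∈-∃++; ∈-allFin)
open import Data.List.Relation.Unary.Any as Any using (Any; here; there)
open import Data.List.Relation.Unary.Any.Properties using (++⁺ˡ)
import Data.List.Relation.Unary.All as All
open import Data.List.Relation.Unary.All.Properties using (¬Any⇒All¬)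
open import Data.List.Relation.Unary.AllPairs using ([]; _∷_)
open import Data.List.Relation.Unary.Unique.Propositional using (Unique)
open import Data.List.Relation.Unary.Unique.Propositional.Properties using (Unique[x∷xs]⇒x∉xs; drop⁺)
open import Data.List.Relation.Binary.Sublist.Propositional using (⊆-refl)
open import Data.List.Relation.Binary.Sublist.Heterogeneous.Properties using (length-mono-≤; ⊆-filter-Sublist)
open import Data.Product using (Σ; _×_; _,_; proj₁; proj₂)
open import Data.Sum using (_⊎_; inj₁; inj₂)
open import Function.Bundles using (_⇔_; mk⇔; Equivalence)
open import Induction.WellFounded using (Acc; acc)
open import Relation.Nullary using (¬_; Dec; yes; no; does; contradiction)
open import Relation.Nullary.Decidable using (_×-dec_; _⊎-dec_; _→-dec_; ¬?; decidable-stable)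
open import Relation.Unary using (Pred; Decidable)
open import Relation.Binary.Definitions using (DecidableEquality)
open import Relation.Binary.PropositionalEquality
  using (_≡_; _≢_; refl; sym; trans; cong; cong₂; subst; subst₂; module ≡-Reasoning)

private variable
  ℓ ℓ′ p q : Level
  A : Set ℓ

indicator : {P : Set p} → Dec P → ℕ
indicator P? = if does P? then 1 else 0

count : {P : Pred A p} → Decidable P → List A → ℕ
count P? xs = length (filter P? xs)

module _ {P : Pred A p} (P? : Decidable P) where

  count-∷ : ∀ x xs → count P? (x ∷ xs) ≡ indicator (P? x) + count P? xs
  count-∷ x xs with P? x
  ... | yes _ = refl
  ... | no _  = refl

  count-map : {B : Set ℓ′} (f : B → A) (xs : List B) → count P? (map f xs) ≡ count (λ x → P? (f x)) xs
  count-map f []       = refl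
  count-map f (x ∷ xs) with P? (f x)
  ... | yes _ = cong suc (count-map f xs)
  ... | no _  = count-map f xs

  count-pos : ∀ {x xs} → x L.∈ xs → P x → 0 < count P? xs
  count-pos x∈ px = filter-some P? (L.lose x∈ px)

  count-witness : ∀ xs → 0 < count P? xs → Σ A P
  count-witness (x ∷ xs) pos with P? x
  ... | yes px = x , px
  ... | no _   = count-witness xs pos

  count-none : (∀ x → ¬ P x) → ∀ xs → count P? xs ≡ 0
  count-none ¬P xs = cong length (filter-none P? (All.universal ¬P xs))

module _ {P : Pred A p} {Q : Pred A q} (P? : Decidable P) (Q? : Decidable Q) where

  count-mono : (∀ {x} → P x → Q x) → ∀ xs → count P? xs ≤ count Q? xs
  count-mono P⊆Q xs = length-mono-≤ (⊆-filter-Sublist P? Q? (λ { refl → P⊆Q }) (⊆-refl {x = xs}))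

  count-< : (∀ {x} → P x → Q x) → ∀ {x xs} → x L.∈ xs → Q x → ¬ P x → count P? xs < count Q? xs
  count-< P⊆Q {xs = y ∷ xs} (here refl) qx ¬px with P? y | Q? y
  ... | yes px | _      = contradiction px ¬px
  ... | no _   | yes _  = s≤s (count-mono P⊆Q xs)
  ... | no _   | no ¬qx = contradiction qx ¬qx
  count-< P⊆Q {xs = y ∷ xs} (there x∈) qx ¬px with P? y | Q? y
  ... | yes _  | yes _  = s≤s (count-< P⊆Q x∈ qx ¬px)
  ... | yes py | no ¬qy = contradiction (P⊆Q py) ¬qy
  ... | no _   | yes _  = m≤n⇒m≤1+n (count-< P⊆Q x∈ qx ¬px)
  ... | no _   | no _   = count-< P⊆Q x∈ qx ¬px

  count-filter : ∀ xs → count Q? (filter P? xs) ≡ count (λ x → P? x ×-dec Q? x) xs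
  count-filter []       = refl
  count-filter (x ∷ xs) with P? x
  ... | no _ = count-filter xs
  ... | yes _ with Q? x
  ...   | yes _ = cong suc (count-filter xs)
  ...   | no _  = count-filter xs

count-cong : {P : Pred A p} {Q : Pred A q} (P? : Decidable P) (Q? : Decidable Q) →
             (∀ {x} → P x → Q x) → (∀ {x} → Q x → P x) → ∀ xs → count P? xs ≡ count Q? xs
count-cong P? Q? P⊆Q Q⊆P xs = ≤-antisym (count-mono P? Q? P⊆Q xs) (count-mono Q? P? Q⊆P xs)

∑ : List A → (A → ℕ) → ℕ
∑ xs f = sum (map f xs)

∑-+ : (xs : List A) (f g : A → ℕ) → ∑ xs (λ x → f x + g x) ≡ ∑ xs f + ∑ xs g
∑-+ []       f g = refl
∑-+ (x ∷ xs) f g = trans (cong (f x + g x +_) (∑-+ xs f g)) (interchange (f x) (g x) (∑ xs f) (∑ xs g))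

∑-mono : (xs : List A) {f g : A → ℕ} → (∀ x → f x ≤ g x) → ∑ xs f ≤ ∑ xs g
∑-mono []       f≤g = z≤n
∑-mono (x ∷ xs) f≤g = +-mono-≤ (f≤g x) (∑-mono xs f≤g)

∑-cong : (xs : List A) {f g : A → ℕ} → (∀ x → f x ≡ g x) → ∑ xs f ≡ ∑ xs g
∑-cong xs f≡g = cong sum (map-cong f≡g xs)

∑-const-0 : (xs : List A) → ∑ xs (λ _ → 0) ≡ 0
∑-const-0 []       = refl
∑-const-0 (_ ∷ xs) = ∑-const-0 xs

∑-const-1 : (xs : List A) → ∑ xs (λ _ → 1) ≡ length xs
∑-const-1 []       = refl
∑-const-1 (_ ∷ xs) = cong suc (∑-const-1 xs)

∑-allFin-suc : ∀ {n} (f : Fin (suc n) → ℕ) → ∑ (allFin (suc n)) f ≡ f zero + ∑ (allFin n) (λ i → f (suc i))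
∑-allFin-suc {n} f =
  cong (λ xs → f zero + sum xs) (trans (map-tabulate suc f) (sym (map-tabulate (λ i → i) (λ i → f (suc i)))))

∑-indicator-≟ : ∀ {n} (z : Fin n) → ∑ (allFin n) (λ v → indicator (z ≟ v)) ≡ 1
∑-indicator-≟ {suc n} zero    =
  trans (∑-allFin-suc {n} (λ v → indicator (zero ≟ v))) (cong suc (∑-const-0 (allFin n)))
∑-indicator-≟ {suc n} (suc z) = trans (∑-allFin-suc {n} (λ v → indicator (suc z ≟ v))) (∑-indicator-≟ z)

∑-count-fibres : ∀ {n} (f : A → Fin n) (ys : List A) → ∑ (allFin n) (λ v → count (λ y → f y ≟ v) ys) ≡ length ys
∑-count-fibres {n = n} f []       = ∑-const-0 (allFin n)
∑-count-fibres {n = n} f (y ∷ ys) = begin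
  ∑ (allFin n) (λ v → count (f-is v) (y ∷ ys))                        ≡⟨ ∑-cong (allFin n) (λ v → count-∷ (f-is v) y ys) ⟩
  ∑ (allFin n) (λ v → indicator (f y ≟ v) + count (f-is v) ys)        ≡⟨ ∑-+ (allFin n) _ _ ⟩
  ∑ (allFin n) (λ v → indicator (f y ≟ v)) + ∑ (allFin n) (λ v → count (f-is v) ys)
                                                                      ≡⟨ cong₂ _+_ (∑-indicator-≟ (f y)) (∑-count-fibres f ys) ⟩
  suc (length ys) ∎
  where
  open ≡-Reasoning
  f-is : ∀ v → Decidable (λ y → f y ≡ v)
  f-is v y = f y ≟ v

count-∈-∷ : ∀ {k} b (p : Subset k) → count (_∈? (b Vec.∷ p)) (tabulate suc) ≡ count (_∈? p) (allFin k)
count-∈-∷ {k} b p = trans (cong (count (_∈? (b Vec.∷ p))) (sym (map-tabulate (λ i → i) suc)))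
                          (trans (count-map (_∈? (b Vec.∷ p)) suc (allFin k))
                                 (count-cong _ (_∈? p) drop-there Vec.there (allFin k)))

∣p∣≡count : ∀ {k} (p : Subset k) → ∣ p ∣ ≡ count (_∈? p) (allFin k)
∣p∣≡count {zero}  Vec.[]            = refl
∣p∣≡count {suc k} (inside Vec.∷ p)  = cong suc (trans (∣p∣≡count p) (sym (count-∈-∷ inside p)))
∣p∣≡count {suc k} (outside Vec.∷ p) = trans (∣p∣≡count p) (sym (count-∈-∷ outside p))

least : ∀ {k} {P : Pred (Fin k) p} → Decidable P →
        (Σ (Fin k) λ i → P i × ∀ {j} → P j → i ≤ᶠ j) ⊎ (∀ i → ¬ P i)
least {k = zero}  P? = inj₂ λ ()
least {k = suc k} P? with P? zero | least (λ i → P? (suc i))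
... | yes p0 | _                  = inj₁ (zero , p0 , λ _ → z≤n)
... | no ¬p0 | inj₁ (i , pi , mi) =
  inj₁ (suc i , pi , λ { {zero} pj → contradiction pj ¬p0 ; {suc j} pj → s≤s (mi pj) })
... | no ¬p0 | inj₂ none          = inj₂ λ { zero pj → ¬p0 pj ; (suc j) pj → none j pj }

greatest : ∀ {k} {P : Pred (Fin k) p} → Decidable P →
           (Σ (Fin k) λ i → P i × ∀ {j} → P j → j ≤ᶠ i) ⊎ (∀ i → ¬ P i)
greatest {k = zero}  P? = inj₂ λ ()
greatest {k = suc k} P? with greatest (λ i → P? (suc i)) | P? zero
... | inj₁ (i , pi , mi) | _      = inj₁ (suc i , pi , λ { {zero} pj → z≤n ; {suc j} pj → s≤s (mi pj) })
... | inj₂ none          | yes p0 = inj₁ (zero , p0 , λ { {zero} _ → z≤n ; {suc j} pj → contradiction pj (none j) })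
... | inj₂ none          | no ¬p0 = inj₂ λ { zero pj → ¬p0 pj ; (suc j) pj → none j pj }

subset : ∀ {k} {P : Pred (Fin k) p} → Decidable P → Subset k
subset P? = Vec.tabulate (λ i → if does (P? i) then inside else outside)

module _ {k} {P : Pred (Fin k) p} (P? : Decidable P) where

  ∈-subset⁺ : ∀ {i} → P i → i ∈ subset P?
  ∈-subset⁺ {i} pi = lookup⇒[]= i _ (trans (lookup∘tabulate _ i) (inside-if-yes (P? i)))
    where
    inside-if-yes : (d : Dec (P i)) → (if does d then inside else outside) ≡ inside
    inside-if-yes (yes _)  = refl
    inside-if-yes (no ¬pi) = contradiction pi ¬pi

  ∈-subset⁻ : ∀ {i} → i ∈ subset P? → P i
  ∈-subset⁻ {i} i∈ = yes-if-inside (P? i) (trans (sym (lookup∘tabulate _ i)) ([]=⇒lookup i∈))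
    where
    yes-if-inside : (d : Dec (P i)) → (if does d then inside else outside) ≡ inside → P i
    yes-if-inside (yes pi) _ = pi
    yes-if-inside (no _)   ()

x∈p─q⇒x∉q : ∀ {k} (p q : Subset k) {x} → x ∈ p ─ q → x ∉ q
x∈p─q⇒x∉q (_ Vec.∷ p) (inside Vec.∷ q) ()         Vec.here
x∈p─q⇒x∉q (_ Vec.∷ p) (_ Vec.∷ q)      (Vec.there x∈) (Vec.there x∈q) = x∈p─q⇒x∉q p q x∈ x∈q

x∈p-y⇒x≢y : ∀ {k} {p : Subset k} {x y} → x ∈ p - y → x ≢ y
x∈p-y⇒x≢y {p = p} {y = y} x∈ refl = x∈p─q⇒x∉q p ⁅ y ⁆ x∈ (x∈⁅x⁆ y)

[m∸k]+1∸n≡m+1∸n∸k : ∀ m n {k} → k ≤ m → (m ∸ k) + 1 ∸ n ≡ m + 1 ∸ n ∸ k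
[m∸k]+1∸n≡m+1∸n∸k m n {k} k≤m = begin
  (m ∸ k) + 1 ∸ n ≡⟨ cong (_∸ n) (sym (+-∸-comm 1 k≤m)) ⟩
  m + 1 ∸ k ∸ n   ≡⟨ ∸-+-assoc (m + 1) k n ⟩
  m + 1 ∸ (k + n) ≡⟨ cong (m + 1 ∸_) (+-comm k n) ⟩
  m + 1 ∸ (n + k) ≡⟨ sym (∸-+-assoc (m + 1) n k) ⟩
  m + 1 ∸ n ∸ k   ∎
  where open ≡-Reasoning

module _ {A : Set ℓ} where

  Unique-∷⁺ : ∀ {x : A} {xs} → ¬ x L.∈ xs → Unique xs → Unique (x ∷ xs)
  Unique-∷⁺ {xs = xs} x∉ u = ¬Any⇒All¬ xs x∉ ∷ u

  Unique-++⁻ʳ : ∀ (xs : List A) {ys} → Unique (xs ++ ys) → Unique ys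
  Unique-++⁻ʳ []       u       = u
  Unique-++⁻ʳ (_ ∷ xs) (_ ∷ u) = Unique-++⁻ʳ xs u

  ∉-prefix⇒Unique : ∀ (w : List A) → (∀ P x s → w ≡ P ++ x ∷ s → ¬ x L.∈ P) → Unique w
  ∉-prefix⇒Unique []      _    = []
  ∉-prefix⇒Unique (y ∷ w) ∉pre =
    ¬Any⇒All¬ w y∉w ∷ ∉-prefix⇒Unique w (λ P x s eq x∈ → ∉pre (y ∷ P) x s (cong (y ∷_) eq) (there x∈))
    where
    y∉w : ¬ y L.∈ w
    y∉w y∈ with ∈-∃++ y∈
    ... | P , s , eq = ∉pre (y ∷ P) y s (cong (y ∷_) eq) (here refl)

  snoc-split : ∀ (L : List A) x P y s → L ++ [ x ] ≡ P ++ y ∷ s →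
               (P ≡ L × y ≡ x × s ≡ []) ⊎ (Σ (List A) λ s₀ → L ≡ P ++ y ∷ s₀ × s ≡ s₀ ++ [ x ])
  snoc-split []      x []      y s eq = inj₁ (refl , sym (∷-injectiveˡ eq) , sym (∷-injectiveʳ eq))
  snoc-split []      x (_ ∷ P) y s eq with ++-conicalʳ P (y ∷ s) (sym (∷-injectiveʳ eq))
  ... | ()
  snoc-split (l ∷ L) x []      y s eq = inj₂ (L , cong (_∷ L) (∷-injectiveˡ eq) , sym (∷-injectiveʳ eq))
  snoc-split (l ∷ L) x (p ∷ P) y s eq with ∷-injective eq
  ... | refl , eq′ with snoc-split L x P y s eq′
  ...   | inj₁ (refl , y≡x , s≡)   = inj₁ (refl , y≡x , s≡)
  ...   | inj₂ (s₀ , L≡ , s≡)       = inj₂ (s₀ , cong (l ∷_) L≡ , s≡)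

  take-suc-length : ∀ (P : List A) x s → take (suc (length P)) (P ++ x ∷ s) ≡ P ++ [ x ]
  take-suc-length []      x s = refl
  take-suc-length (y ∷ P) x s = cong (y ∷_) (take-suc-length P x s)

  Unique-middle : ∀ (P : List A) {x s} → Unique (P ++ x ∷ s) → ¬ x L.∈ P
  Unique-middle (y ∷ P) (y≢ ∷ _) (here refl) = All.lookup y≢ (∈-++⁺ʳ P (here refl)) refl
  Unique-middle (y ∷ P) (_ ∷ u)  (there x∈)  = Unique-middle P u x∈

  []≢++∷ : ∀ (P : List A) {x s} → [] ≢ P ++ x ∷ s
  []≢++∷ []      ()
  []≢++∷ (_ ∷ P) ()

  data FirstDifference (w z : List A) : Set ℓ where
    equal     : w ≡ z → FirstDifference w z
    extends   : ∀ {y s} → z ≡ w ++ y ∷ s → FirstDifference w z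
    extended  : ∀ {x s} → w ≡ z ++ x ∷ s → FirstDifference w z
    differ    : ∀ P {x y s s′} → x ≢ y → w ≡ P ++ x ∷ s → z ≡ P ++ y ∷ s′ → FirstDifference w z

  firstDifference : DecidableEquality A → ∀ w z → FirstDifference w z
  firstDifference _≟_ []      []      = equal refl
  firstDifference _≟_ []      (y ∷ z) = extends refl
  firstDifference _≟_ (x ∷ w) []      = extended refl
  firstDifference _≟_ (x ∷ w) (y ∷ z) with x ≟ y
  ... | no x≢y = differ [] x≢y refl refl
  ... | yes refl with firstDifference _≟_ w z
  ...   | equal w≡z              = equal (cong (x ∷_) w≡z)
  ...   | extends z≡             = extends (cong (x ∷_) z≡)
  ...   | extended w≡            = extended (cong (x ∷_) w≡)
  ...   | differ P x≢y w≡ z≡    = differ (x ∷ P) x≢y (cong (x ∷_) w≡) (cong (x ∷_) z≡)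

module _ (G : Digraph) where

  private variable
    Y Y′ : Subset (m G)
    a b c : V G

  reach-mono : Y ⊆ Y′ → Reach G Y a b → Reach G Y′ a b
  reach-mono Y⊆Y′ here             = here
  reach-mono Y⊆Y′ (step e e∈ s≡ ρ) = step e (Y⊆Y′ e∈) s≡ (reach-mono Y⊆Y′ ρ)

  reach-trans : Reach G Y a b → Reach G Y b c → Reach G Y a c
  reach-trans here             σ = σ
  reach-trans (step e e∈ s≡ ρ) σ = step e e∈ s≡ (reach-trans ρ σ)

  reach-snoc : ∀ {e} → Reach G Y a (src G e) → e ∈ Y → Reach G Y a (tgt G e)
  reach-snoc ρ e∈ = reach-trans ρ (step _ e∈ refl here)

  reach⇒last-edge : Reach G Y a b → a ≢ b → Σ (E G) λ f → f ∈ Y × tgt G f ≡ b × Reach G Y a (src G f)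
  reach⇒last-edge here             a≢b = contradiction refl a≢b
  reach⇒last-edge (step e e∈ s≡ ρ) _   = last e e∈ s≡ ρ
    where
    last : ∀ {a b} e → e ∈ Y → src G e ≡ a → Reach G Y (tgt G e) b →
           Σ (E G) λ f → f ∈ Y × tgt G f ≡ b × Reach G Y a (src G f)
    last e e∈ refl here               = e , e∈ , refl , here
    last e e∈ refl (step e′ e′∈ s≡ ρ) with last e′ e′∈ s≡ ρ
    ... | f , f∈ , f→ , σ = f , f∈ , f→ , step e e∈ refl σ

  reach-avoid-or-after : ∀ e → Reach G Y a b → Reach G (Y - e) a b ⊎ Reach G (Y - e) (tgt G e) b
  reach-avoid-or-after e here = inj₁ here
  reach-avoid-or-after e (step e′ e′∈ s≡ ρ) with reach-avoid-or-after e ρ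
  ... | inj₂ σ = inj₂ σ
  ... | inj₁ σ with e′ ≟ e
  ...   | yes refl = inj₂ σ
  ...   | no e′≢e  = inj₁ (step e′ (x∈p∧x≢y⇒x∈p-y e′∈ e′≢e) s≡ σ)

  Step : E G → V G → V G → Set
  Step e a b = (src G e ≡ a × tgt G e ≡ b) ⊎ (tgt G e ≡ a × src G e ≡ b)

  step-other-end : ∀ {e a′ b′} → Step e a b → Step e a′ b′ → b′ ≢ a → b′ ≡ b
  step-other-end (inj₁ (s≡ , t≡)) (inj₁ (s≡′ , t≡′)) _    = trans (sym t≡′) t≡
  step-other-end (inj₁ (s≡ , t≡)) (inj₂ (t≡′ , s≡′)) b′≢a = contradiction (trans (sym s≡′) s≡) b′≢a
  step-other-end (inj₂ (t≡ , s≡)) (inj₁ (s≡′ , t≡′)) b′≢a = contradiction (trans (sym t≡′) t≡) b′≢a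
  step-other-end (inj₂ (t≡ , s≡)) (inj₂ (t≡′ , s≡′)) _    = trans (sym s≡′) s≡

  uwalk-∷ : ∀ {e es} → e ∈ Y → Step e a b → UWalk G Y b c es → UWalk G Y a c (e ∷ es)
  uwalk-∷ e∈ (inj₁ (s≡ , refl)) ω = cons _ e∈ (inj₁ (s≡ , ω))
  uwalk-∷ e∈ (inj₂ (t≡ , refl)) ω = cons _ e∈ (inj₂ (t≡ , ω))

  uwalk-uncons : ∀ {e es} → UWalk G Y a c (e ∷ es) → e ∈ Y × Σ (V G) λ b → Step e a b × UWalk G Y b c es
  uwalk-uncons (cons e e∈ (inj₁ (s≡ , ω))) = e∈ , _ , inj₁ (s≡ , refl) , ω
  uwalk-uncons (cons e e∈ (inj₂ (t≡ , ω))) = e∈ , _ , inj₂ (t≡ , refl) , ω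

  uwalk-edges : ∀ {es} → UWalk G Y a b es → ∀ {e} → e L.∈ es → e ∈ Y
  uwalk-edges ω (here refl) = proj₁ (uwalk-uncons ω)
  uwalk-edges (cons _ _ (inj₁ (_ , ω))) (there e∈) = uwalk-edges ω e∈
  uwalk-edges (cons _ _ (inj₂ (_ , ω))) (there e∈) = uwalk-edges ω e∈

  uwalk-mono : ∀ {es} → Y ⊆ Y′ → UWalk G Y a b es → UWalk G Y′ a b es
  uwalk-mono Y⊆Y′ nil                          = nil
  uwalk-mono Y⊆Y′ (cons e e∈ (inj₁ (s≡ , ω))) = cons e (Y⊆Y′ e∈) (inj₁ (s≡ , uwalk-mono Y⊆Y′ ω))
  uwalk-mono Y⊆Y′ (cons e e∈ (inj₂ (t≡ , ω))) = cons e (Y⊆Y′ e∈) (inj₂ (t≡ , uwalk-mono Y⊆Y′ ω))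

  uwalk-++ : ∀ {es fs} → UWalk G Y a b es → UWalk G Y b c fs → UWalk G Y a c (es ++ fs)
  uwalk-++ nil                          ω′ = ω′
  uwalk-++ (cons e e∈ (inj₁ (s≡ , ω))) ω′ = cons e e∈ (inj₁ (s≡ , uwalk-++ ω ω′))
  uwalk-++ (cons e e∈ (inj₂ (t≡ , ω))) ω′ = cons e e∈ (inj₂ (t≡ , uwalk-++ ω ω′))

  UWalkBetween : Subset (m G) → V G → V G → Set
  UWalkBetween Y a b = Σ (List (E G)) (UWalk G Y a b)

  uwalk-reverse : ∀ {es} → UWalk G Y a b es → UWalkBetween Y b a
  uwalk-reverse nil = [] , nil
  uwalk-reverse (cons e e∈ (inj₁ (s≡ , ω))) with uwalk-reverse ω
  ... | es′ , ω′ = es′ ++ [ e ] , uwalk-++ ω′ (uwalk-∷ e∈ (inj₂ (refl , s≡)) nil)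
  uwalk-reverse (cons e e∈ (inj₂ (t≡ , ω))) with uwalk-reverse ω
  ... | es′ , ω′ = es′ ++ [ e ] , uwalk-++ ω′ (uwalk-∷ e∈ (inj₁ (refl , t≡)) nil)

  reach⇒uwalk : Reach G Y a b → UWalkBetween Y a b
  reach⇒uwalk here = [] , nil
  reach⇒uwalk (step e e∈ s≡ ρ) with reach⇒uwalk ρ
  ... | es , ω = e ∷ es , cons e e∈ (inj₁ (s≡ , ω))

  uwalk-split : ∀ es {e fs} → UWalk G Y a c (es ++ e ∷ fs) →
                Σ (V G) λ a′ → Σ (V G) λ b′ → UWalk G Y a a′ es × Step e a′ b′ × UWalk G Y b′ c fs
  uwalk-split []       ω with uwalk-uncons ω
  ... | _ , _ , st , ω′ = _ , _ , nil , st , ω′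
  uwalk-split (x ∷ es) ω with uwalk-uncons ω
  ... | x∈ , _ , st , ω′ with uwalk-split es ω′
  ...   | _ , _ , ω₁ , st′ , ω₂ = _ , _ , uwalk-∷ x∈ st ω₁ , st′ , ω₂

  Trail : Subset (m G) → V G → V G → Set
  Trail Y a b = Σ (List (E G)) λ ts → Unique ts × UWalk G Y a b ts

  -- If e already occurs in the trail, keep only the part after that occurrence, preceded by e
  -- unless that occurrence of e already leaves from a.
  trail-∷ : ∀ {e} → e ∈ Y → Step e a b → Trail Y b c → Trail Y a c
  trail-∷ {Y = Y} {a = a} {c = c} {e = e} e∈ st (ts , uts , ω) with Any.any? (e ≟_) ts
  ... | no e∉ = e ∷ ts , Unique-∷⁺ e∉ uts , uwalk-∷ e∈ st ω
  ... | yes e∈ts with ∈-∃++ e∈ts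
  ...   | xs , ys , refl with uwalk-split xs ω
  ...     | _ , b′ , _ , st′ , ω₂ with b′ ≟ a
  ...       | yes refl = ys , drop⁺ 1 (Unique-++⁻ʳ xs uts) , ω₂
  ...       | no b′≢a  = e ∷ ys , Unique-++⁻ʳ xs uts ,
                         uwalk-∷ e∈ st (subst (λ v → UWalk G Y v c ys) (step-other-end st st′ b′≢a) ω₂)

  uwalk⇒trail : ∀ {es} → UWalk G Y a b es → Trail Y a b
  uwalk⇒trail nil = [] , [] , nil
  uwalk⇒trail (cons e e∈ (inj₁ (s≡ , ω))) = trail-∷ e∈ (inj₁ (s≡ , refl)) (uwalk⇒trail ω)
  uwalk⇒trail (cons e e∈ (inj₂ (t≡ , ω))) = trail-∷ e∈ (inj₂ (t≡ , refl)) (uwalk⇒trail ω)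

  closing-edge⇒ucycle : ∀ {e es} → e ∈ Y → UWalk G (Y - e) (tgt G e) (src G e) es → HasUCycle G Y
  closing-edge⇒ucycle {e = e} e∈ ω with uwalk⇒trail ω
  ... | ts , uts , ω′ = src G e , e , ts , Unique-∷⁺ (λ i → x∈p-y⇒x≢y (uwalk-edges ω′ i) refl) uts ,
                        cons e e∈ (inj₁ (refl , uwalk-mono (p─q⊆p _ _) ω′))

  back-path⇒ucycle : ∀ {e} → e ∈ Y → Reach G Y (tgt G e) (src G e) → HasUCycle G Y
  back-path⇒ucycle {e = e} e∈ ρ with reach-avoid-or-after e ρ
  ... | inj₁ σ = closing-edge⇒ucycle e∈ (proj₂ (reach⇒uwalk σ))
  ... | inj₂ σ = closing-edge⇒ucycle e∈ (proj₂ (reach⇒uwalk σ))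

  -- Potentials and acyclic sets

  -- Along a trail, an edge entered forwards can only be followed by forward edges (in-degree ≤ 1),
  -- so a closed trail would force the potential to increase strictly around it.
  module _ {Y : Subset (m G)} (t : V G → ℕ)
           (increasing : ∀ {e} → e ∈ Y → t (src G e) < t (tgt G e))
           (tgt-injective : ∀ {e₁ e₂} → e₁ ∈ Y → e₂ ∈ Y → tgt G e₁ ≡ tgt G e₂ → e₁ ≡ e₂) where

    private
      forwards : ∀ {e es} → e ∈ Y → src G e ≡ a → UWalk G Y (tgt G e) b es → Unique (e ∷ es) →
                 t a < t b × Σ (E G) λ e′ → e′ L.∈ (e ∷ es) × tgt G e′ ≡ b
      forwards e∈ refl nil _ = increasing e∈ , _ , here refl , refl
      forwards e∈ refl (cons e₁ e₁∈ (inj₁ (s≡ , ω))) (_ ∷ u) with forwards e₁∈ s≡ ω u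
      ... | lt , e′ , e′∈ , t≡ = <-trans (increasing e∈) lt , e′ , there e′∈ , t≡
      forwards e∈ refl (cons e₁ e₁∈ (inj₂ (t≡ , ω))) u =
        ⊥-elim (Unique[x∷xs]⇒x∉xs u (subst (L._∈ _) (tgt-injective e₁∈ e∈ t≡) (here refl)))

      backwards : ∀ {e es} → e ∈ Y → tgt G e ≡ a → UWalk G Y (src G e) b es → Unique (e ∷ es) →
                  t b < t a ⊎ Σ (E G) λ e′ → e′ L.∈ es × tgt G e′ ≡ b
      backwards e∈ refl nil _ = inj₁ (increasing e∈)
      backwards e∈ refl (cons e₁ e₁∈ (inj₁ (s≡ , ω))) (_ ∷ u) with forwards e₁∈ s≡ ω u
      ... | _ , e′ , e′∈ , t≡ = inj₂ (e′ , e′∈ , t≡)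
      backwards e∈ refl (cons e₁ e₁∈ (inj₂ (t≡ , ω))) (_ ∷ u) with backwards e₁∈ t≡ ω u
      ... | inj₁ lt                = inj₁ (<-trans lt (increasing e∈))
      ... | inj₂ (e′ , e′∈ , t≡′) = inj₂ (e′ , there e′∈ , t≡′)

    no-ucycle-by-potential : ¬ HasUCycle G Y
    no-ucycle-by-potential (_ , e , _ , u , cons _ e∈ (inj₁ (s≡ , ω))) = <-irrefl refl (proj₁ (forwards e∈ s≡ ω u))
    no-ucycle-by-potential (_ , e , es , u , cons _ e∈ (inj₂ (t≡ , ω))) with backwards e∈ t≡ ω u
    ... | inj₁ lt                = <-irrefl refl lt
    ... | inj₂ (e′ , e′∈ , t≡′) =
      Unique[x∷xs]⇒x∉xs u (subst (L._∈ es) (tgt-injective (uwalk-edges ω e′∈) e∈ (trans t≡′ (sym t≡))) e′∈)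

  Backward : (V G → ℕ) → Subset (m G)
  Backward t = subset (λ e → t (tgt G e) ≤? t (src G e))

  module _ (t : V G → ℕ) where

    ∉-Backward⇒< : ∀ {e} → e ∈ ∁ (Backward t) → t (src G e) < t (tgt G e)
    ∉-Backward⇒< e∈ = ≰⇒> λ le → x∈∁p⇒x∉p e∈ (∈-subset⁺ (λ e → t (tgt G e) ≤? t (src G e)) le)

    <⇒∉-Backward : ∀ {e} → t (src G e) < t (tgt G e) → e ∈ ∁ (Backward t)
    <⇒∉-Backward lt = x∉p⇒x∈∁p λ e∈ → <⇒≱ lt (∈-subset⁻ (λ e → t (tgt G e) ≤? t (src G e)) e∈)

  module _ {D : Subset (m G)} (acyclic : Acyclic G D) {S : V G → Set} (S? : Decidable S) where

    Predecessor : V G → Set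
    Predecessor u = Σ (E G) λ e → e ∈ D × tgt G e ≡ u × S (src G e)

    predecessor? : ∀ u → Dec (Predecessor u)
    predecessor? u = Fin.any? (λ e → (e ∈? D) ×-dec (tgt G e ≟ u) ×-dec S? (src G e))

    -- If every vertex of S had a predecessor in S, walking back |V| steps from u₀ would repeat a vertex.
    acyclic⇒source : ∀ {u₀} → S u₀ → Σ (V G) λ u → S u × ¬ Predecessor u
    acyclic⇒source {u₀} s₀ with Fin.any? (λ u → S? u ×-dec ¬? (predecessor? u))
    ... | yes source           = source
    ... | no no-source         = ⊥-elim (acyclic (edge i , edge∈ i , back-path))
      where
      predecessor : ∀ {u} → S u → Predecessor u
      predecessor {u} su = decidable-stable (predecessor? u) (λ ¬pred → no-source (u , su , ¬pred))

      walk : ℕ → Σ (V G) S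
      walk zero    = u₀ , s₀
      walk (suc i) = let (_ , _ , _ , se) = predecessor (proj₂ (walk i)) in _ , se

      vertex : ℕ → V G
      vertex i = proj₁ (walk i)

      edge : ℕ → E G
      edge i = proj₁ (predecessor (proj₂ (walk i)))

      edge∈ : ∀ i → edge i ∈ D
      edge∈ i = proj₁ (proj₂ (predecessor (proj₂ (walk i))))

      tgt-edge : ∀ i → tgt G (edge i) ≡ vertex i
      tgt-edge i = proj₁ (proj₂ (proj₂ (predecessor (proj₂ (walk i)))))

      walk-reach : ∀ i d → Reach G D (vertex (d + i)) (vertex i)
      walk-reach i zero    = here
      walk-reach i (suc d) = step (edge (d + i)) (edge∈ (d + i)) refl
                               (subst (λ v → Reach G D v (vertex i)) (sym (tgt-edge (d + i))) (walk-reach i d))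

      repetition = Fin.pigeonhole (≤-refl {suc (n G)}) (λ k → vertex (toℕ k))
      i = toℕ (proj₁ repetition)
      j = toℕ (proj₁ (proj₂ repetition))

      back-path : Reach G D (tgt G (edge i)) (src G (edge i))
      back-path = subst (λ v → Reach G D v (vertex (suc i)))
                        (trans (cong vertex (m∸n+n≡m (proj₁ (proj₂ (proj₂ repetition)))))
                               (sym (trans (tgt-edge i) (proj₂ (proj₂ (proj₂ repetition))))))
                        (walk-reach (suc i) (j ∸ suc i))

  ∈-toSet⁺ : ∀ {e L} → e L.∈ L → e ∈ toSet G L
  ∈-toSet⁺ {L = x ∷ L} (here refl) = x∈p∪q⁺ (inj₂ (x∈⁅x⁆ x))
  ∈-toSet⁺ {L = x ∷ L} (there e∈)  = x∈p∪q⁺ (inj₁ (∈-toSet⁺ e∈))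

  ∈-toSet⁻ : ∀ {e} L → e ∈ toSet G L → e L.∈ L
  ∈-toSet⁻ []      e∈ = ⊥-elim (∉⊥ e∈)
  ∈-toSet⁻ (x ∷ L) e∈ with x∈p∪q⁻ (toSet G L) ⁅ x ⁆ e∈
  ... | inj₁ e∈L = there (∈-toSet⁻ L e∈L)
  ... | inj₂ e≡x = here (x∈⁅y⁆⇒x≡y x e≡x)

  <lex-irrefl : ∀ {w} → ¬ _<lex_ G w w
  <lex-irrefl (head< lt) = <-irrefl refl lt
  <lex-irrefl (tail< lt) = <lex-irrefl lt

  <lex-trans : ∀ {u v w} → _<lex_ G u v → _<lex_ G v w → _<lex_ G u w
  <lex-trans []<∷       (head< _)  = []<∷
  <lex-trans []<∷       (tail< _)  = []<∷
  <lex-trans (head< lt) (head< lt′) = head< (<-trans lt lt′)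
  <lex-trans (head< lt) (tail< _)   = head< lt
  <lex-trans (tail< _)  (head< lt′) = head< lt′
  <lex-trans (tail< lt) (tail< lt′) = tail< (<lex-trans lt lt′)

  <lex-asym : ∀ {v w} → _<lex_ G v w → ¬ _<lex_ G w v
  <lex-asym lt lt′ = <lex-irrefl (<lex-trans lt lt′)

  <lex-++ : ∀ P {v w} → _<lex_ G v w → _<lex_ G (P ++ v) (P ++ w)
  <lex-++ []      lt = lt
  <lex-++ (x ∷ P) lt = tail< (<lex-++ P lt)

  <lex-at : ∀ P {x y s s′ w z} → x <ᶠ y → w ≡ P ++ x ∷ s → z ≡ P ++ y ∷ s′ → _<lex_ G w z
  <lex-at P x<y refl refl = <lex-++ P (head< x<y)

  <lex-extends : ∀ {w y s z} → z ≡ w ++ y ∷ s → _<lex_ G w z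
  <lex-extends {w} {y} {s} refl = subst (λ u → _<lex_ G u (w ++ y ∷ s)) (++-identityʳ w) (<lex-++ w []<∷)

  inDegree : {P : Pred (E G) p} → Decidable P → V G → ℕ
  inDegree P? v = count (λ e → P? e ×-dec tgt G e ≟ v) (allFin (m G))

  ∑-inDegree : {P : Pred (E G) p} (P? : Decidable P) → ∑ (allFin (n G)) (inDegree P?) ≡ count P? (allFin (m G))
  ∑-inDegree P? = trans (∑-cong (allFin (n G)) (λ v → sym (count-filter P? (λ e → tgt G e ≟ v) (allFin (m G)))))
                        (∑-count-fibres (tgt G) (filter P? (allFin (m G))))

  weight+n : (p : V G → ℕ) → weight G p + n G ≡ ∑ (allFin (n G)) (λ v → p v + 1)
  weight+n p = sym (trans (∑-+ (allFin (n G)) p (λ _ → 1))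
                          (cong (weight G p +_) (trans (∑-const-1 (allFin (n G))) (length-tabulate (λ i → i)))))

  forward? : (t : V G → ℕ) → Decidable (λ e → t (src G e) < t (tgt G e))
  forward? t e = t (src G e) <? t (tgt G e)

  module _ (r : V G) where

    module _ {X : Subset (m G)} (fX : Feasible G r X) where

      feasible-no-loop : ∀ {e} → e ∈ X → src G e ≢ tgt G e
      feasible-no-loop e∈ s≡t = proj₂ fX (back-path⇒ucycle e∈ (subst (Reach G X _) (sym s≡t) here))

      feasible-tgt≢root : ∀ {e} → e ∈ X → tgt G e ≢ r
      feasible-tgt≢root {e} e∈ t≡r =
        proj₂ fX (back-path⇒ucycle e∈ (subst (λ v → Reach G X v (src G e)) (sym t≡r) (proj₁ (proj₁ fX e e∈))))

      -- Two edges into the same vertex close an undirected cycle through the paths from r.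
      feasible-tgt-injective : ∀ {e₁ e₂} → e₁ ∈ X → e₂ ∈ X → tgt G e₁ ≡ tgt G e₂ → e₁ ≡ e₂
      feasible-tgt-injective {e₁} {e₂} e₁∈ e₂∈ t≡ with e₁ ≟ e₂
      ... | yes e₁≡e₂ = e₁≡e₂
      ... | no e₁≢e₂ with reach-avoid-or-after e₁ (proj₁ (proj₁ fX e₁ e₁∈))
      ...   | inj₂ σ = ⊥-elim (proj₂ fX (closing-edge⇒ucycle e₁∈ (proj₂ (reach⇒uwalk σ))))
      ...   | inj₁ ρ₁ with reach-avoid-or-after e₁ (proj₁ (proj₁ fX e₂ e₂∈))
      ...     | inj₂ σ = ⊥-elim (proj₂ fX (back-path⇒ucycle e₂∈
                           (subst (λ v → Reach G X v (src G e₂)) t≡ (reach-mono (p─q⊆p _ _) σ))))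
      ...     | inj₁ ρ₂ with uwalk-reverse (proj₂ (reach⇒uwalk ρ₂)) | reach⇒uwalk ρ₁
      ...       | _ , ω₂ | _ , ω₁ = ⊥-elim (proj₂ fX (closing-edge⇒ucycle e₁∈
                    (uwalk-∷ (x∈p∧x≢y⇒x∈p-y e₂∈ (λ e₂≡e₁ → e₁≢e₂ (sym e₂≡e₁))) (inj₂ (sym t≡ , refl))
                             (uwalk-++ ω₂ ω₁))))

    module _ (A : Subset (m G)) (t : V G → ℕ) {Q : V G → Set}
             (descent : ∀ {v} → Q v → v ≢ r →
                        Σ (E G) λ e → e ∈ A × tgt G e ≡ v × Q (src G e) × t (src G e) < t v) where

      reach-by-descent : ∀ {v} → Q v → Reach G A r v
      reach-by-descent {v} = go v (<-wellFounded (t v))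
        where
        go : ∀ v → Acc _<_ (t v) → Q v → Reach G A r v
        go v (acc rec) qv with v ≟ r
        ... | yes refl = here
        ... | no v≢r with descent qv v≢r
        ...   | e , e∈ , refl , qs , lt = reach-snoc (go (src G e) (rec lt) qs) e∈

    module _ (t : V G → ℕ) where

      Backward-isConnFAS : (∀ v → v ≢ r → Σ (E G) λ e → tgt G e ≡ v × t (src G e) < t v) →
                           IsConnFAS G r (Backward t)
      Backward-isConnFAS entered = (λ v → reach-by-descent _ t descent {v} tt) , acyclic
        where
        descent : ∀ {v} → Unit → v ≢ r →
                  Σ (E G) λ e → e ∈ ∁ (Backward t) × tgt G e ≡ v × Unit × t (src G e) < t v
        descent {v} _ v≢r with entered v v≢r
        ... | e , refl , lt = e , <⇒∉-Backward t lt , refl , tt , lt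
        acyclic : Acyclic G (∁ (Backward t))
        acyclic (e , e∈ , ρ) = <⇒≱ (∉-Backward⇒< t e∈) (nondecreasing ρ)
          where
          nondecreasing : ∀ {a b} → Reach G (∁ (Backward t)) a b → t a ≤ t b
          nondecreasing here               = ≤-refl
          nondecreasing (step e e∈ refl ρ) = ≤-trans (<⇒≤ (∉-Backward⇒< t e∈)) (nondecreasing ρ)

    potential⇒feasible : {Y : Subset (m G)} (t : V G → ℕ) →
                         (∀ {e} → e ∈ Y → t (src G e) < t (tgt G e)) →
                         (∀ {e₁ e₂} → e₁ ∈ Y → e₂ ∈ Y → tgt G e₁ ≡ tgt G e₂ → e₁ ≡ e₂) →
                         (∀ v → v ≢ r → Σ (E G) λ e → e ∈ Y × tgt G e ≡ v) → Feasible G r Y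
    potential⇒feasible {Y} t increasing injective entered =
      (λ e _ → reach (src G e) , reach (tgt G e)) , no-ucycle-by-potential t increasing injective
      where
      descent : ∀ {v} → Unit → v ≢ r → Σ (E G) λ e → e ∈ Y × tgt G e ≡ v × Unit × t (src G e) < t v
      descent {v} _ v≢r with entered v v≢r
      ... | e , e∈ , refl = e , e∈ , refl , tt , increasing e∈
      reach : ∀ v → Reach G Y r v
      reach v = reach-by-descent Y t descent tt

    connFAS-root-unentered : ∀ {F} → IsConnFAS G r F → ∀ {e} → e ∈ ∁ F → tgt G e ≢ r
    connFAS-root-unentered {F} (connected , acyclic) {e} e∈ t≡r =
      acyclic (e , e∈ , subst (λ v → Reach G (∁ F) v (src G e)) (sym t≡r) (connected (src G e)))

    private variable
      P L s w : List (E G)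
      e : E G
      v : V G

    -- Words and the time at which they reach a vertex

    Reached : List (E G) → V G → Set
    Reached L v = v ≡ r ⊎ Any (λ e → tgt G e ≡ v) L

    reached? : ∀ L v → Dec (Reached L v)
    reached? L v = (v ≟ r) ⊎-dec Any.any? (λ e → tgt G e ≟ v) L

    reached-++ : ∀ s → Reached P v → Reached (P ++ s) v
    reached-++ s (inj₁ v≡r) = inj₁ v≡r
    reached-++ s (inj₂ hit) = inj₂ (++⁺ˡ hit)

    reached-tgt : e L.∈ L → Reached L (tgt G e)
    reached-tgt e∈ = inj₂ (L.lose e∈ refl)

    -- The 1-based position of the first edge of L entering v, or 1 + length L if there is none.
    firstEntry : List (E G) → V G → ℕ
    firstEntry []      v = 1
    firstEntry (e ∷ L) v = if does (tgt G e ≟ v) then 1 else suc (firstEntry L v)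

    time : List (E G) → V G → ℕ
    time L v = if does (v ≟ r) then 0 else firstEntry L v

    firstEntry-hit : ∀ P {s v} → Any (λ e → tgt G e ≡ v) P → firstEntry (P ++ s) v ≤ length P
    firstEntry-hit (e ∷ P) {v = v} hit with tgt G e ≟ v | hit
    ... | yes _    | _          = s≤s z≤n
    ... | no t≢v   | here t≡v   = contradiction t≡v t≢v
    ... | no _     | there hit′ = s≤s (firstEntry-hit P hit′)

    firstEntry-miss : ∀ P {s v} → ¬ Any (λ e → tgt G e ≡ v) P → firstEntry (P ++ s) v ≡ length P + firstEntry s v
    firstEntry-miss []      miss = refl
    firstEntry-miss (e ∷ P) {v = v} miss with tgt G e ≟ v
    ... | yes t≡v = contradiction (here t≡v) miss
    ... | no _    = cong suc (firstEntry-miss P (λ hit → miss (there hit)))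

    firstEntry-pos : ∀ L v → 0 < firstEntry L v
    firstEntry-pos []      v = s≤s z≤n
    firstEntry-pos (e ∷ L) v with tgt G e ≟ v
    ... | yes _ = s≤s z≤n
    ... | no _  = s≤s z≤n

    time-≤ : ∀ P s → Reached P v → time (P ++ s) v ≤ length P
    time-≤ {v} P s ρ with v ≟ r | ρ
    ... | yes _   | _          = z≤n
    ... | no v≢r  | inj₁ v≡r   = contradiction v≡r v≢r
    ... | no _    | inj₂ hit   = firstEntry-hit P hit

    time->-unreached : ∀ P s → ¬ Reached P v → length P < time (P ++ s) v
    time->-unreached {v} P s ¬ρ with v ≟ r
    ... | yes v≡r = contradiction (inj₁ v≡r) ¬ρ
    ... | no _    rewrite firstEntry-miss P {s} (λ hit → ¬ρ (inj₂ hit)) =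
      subst (_≤ length P + firstEntry s v) (+-comm (length P) 1) (+-monoʳ-≤ (length P) (firstEntry-pos s v))

    time-increases : ∀ {a b} P s → Reached P a → ¬ Reached P b → time (P ++ s) a < time (P ++ s) b
    time-increases P s ρa ¬ρb = ≤-<-trans (time-≤ P s ρa) (time->-unreached P s ¬ρb)

    time-≤⇒reached : ∀ {v} P s → time (P ++ s) v ≤ length P → Reached P v
    time-≤⇒reached {v} P s le = decidable-stable (reached? P v) (λ ¬ρ → <⇒≱ (time->-unreached P s ¬ρ) le)

    Growing : List (E G) → Set
    Growing w = ∀ P e s → w ≡ P ++ e ∷ s → Reached P (src G e) × ¬ Reached P (tgt G e)

    growing-[] : Growing []
    growing-[] P e s eq = ⊥-elim ([]≢++∷ P eq)

    growing-prefix : ∀ P s → Growing (P ++ s) → Growing P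
    growing-prefix P s γ Q e s′ refl = γ Q e (s′ ++ s) (++-assoc Q (e ∷ s′) s)

    growing-snoc : ∀ P → Growing P → Reached P (src G e) → ¬ Reached P (tgt G e) → Growing (P ++ [ e ])
    growing-snoc {e} P γ ρs ¬ρt Q x s eq with snoc-split P e Q x s eq
    ... | inj₁ (refl , refl , refl) = ρs , ¬ρt
    ... | inj₂ (s₀ , P≡ , _)        = γ Q x s₀ P≡

    growing-∉-prefix : ∀ P s → Growing (P ++ e ∷ s) → ¬ e L.∈ P
    growing-∉-prefix P s γ e∈P = proj₂ (γ P _ s refl) (reached-tgt e∈P)

    growing-tgt-injective : Growing w → ∀ {e e′} → e L.∈ w → e′ L.∈ w → tgt G e ≡ tgt G e′ → e ≡ e′
    growing-tgt-injective γ e∈ e′∈ t≡ with ∈-∃++ e∈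
    ... | P , s , refl with ∈-++⁻ P e′∈
    ...   | inj₁ e′∈P        = ⊥-elim (proj₂ (γ P _ s refl) (subst (Reached P) (sym t≡) (reached-tgt e′∈P)))
    ...   | inj₂ (here e′≡e) = sym e′≡e
    ...   | inj₂ (there e′∈s) with ∈-∃++ e′∈s
    ...     | s₁ , s₂ , refl = ⊥-elim (proj₂ (γ (P ++ _ ∷ s₁) _ s₂ (sym (++-assoc P (_ ∷ s₁) (_ ∷ s₂))))
                                        (subst (Reached _) t≡ (reached-tgt (∈-++⁺ʳ P (here refl)))))

    growing⇒unique : Growing w → Unique w
    growing⇒unique γ = ∉-prefix⇒Unique _ λ { P x s refl → growing-∉-prefix P s γ }

    growing-increasing : Growing w → e L.∈ w → time w (src G e) < time w (tgt G e)
    growing-increasing γ e∈ with ∈-∃++ e∈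
    ... | P , s , refl = let ρs , ¬ρt = γ P _ s refl in time-increases P (_ ∷ s) ρs ¬ρt

    growing-src-reached : Growing w → e L.∈ w → Reached w (src G e)
    growing-src-reached γ e∈ with ∈-∃++ e∈
    ... | P , s , refl = reached-++ (_ ∷ s) (proj₁ (γ P _ s refl))

    growing-reach : Growing w → Reached w v → Reach G (toSet G w) r v
    growing-reach {w} γ = reach-by-descent (toSet G w) (time w) descent
      where
      descent : ∀ {v} → Reached w v → v ≢ r →
                Σ (E G) λ e → e ∈ toSet G w × tgt G e ≡ v × Reached w (src G e) × time w (src G e) < time w v
      descent (inj₁ v≡r) v≢r = contradiction v≡r v≢r
      descent (inj₂ hit) _ with L.find hit
      ... | e , e∈ , refl = e , ∈-toSet⁺ e∈ , refl , growing-src-reached γ e∈ , growing-increasing γ e∈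

    growing⇒feasible : Growing w → Feasible G r (toSet G w)
    growing⇒feasible {w} γ = reachable , no-ucycle-by-potential (time w) increasing injective
      where
      reachable : ∀ e → e ∈ toSet G w → Reach G (toSet G w) r (src G e) × Reach G (toSet G w) r (tgt G e)
      reachable e e∈ = growing-reach γ (growing-src-reached γ (∈-toSet⁻ w e∈)) ,
                       growing-reach γ (reached-tgt (∈-toSet⁻ w e∈))
      increasing : ∀ {e} → e ∈ toSet G w → time w (src G e) < time w (tgt G e)
      increasing e∈ = growing-increasing γ (∈-toSet⁻ w e∈)
      injective : ∀ {e e′} → e ∈ toSet G w → e′ ∈ toSet G w → tgt G e ≡ tgt G e′ → e ≡ e′
      injective e∈ e′∈ = growing-tgt-injective γ (∈-toSet⁻ w e∈) (∈-toSet⁻ w e′∈)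

    growing⇒prefixes-feasible : Growing w → ∀ i → Feasible G r (toSet G (take i w))
    growing⇒prefixes-feasible {w} γ i =
      growing⇒feasible (growing-prefix (take i w) (drop i w) (subst Growing (sym (take++drop≡id i w)) γ))

    prefixes-feasible⇒growing : Unique w → (∀ i → Feasible G r (toSet G (take i w))) → Growing w
    prefixes-feasible⇒growing {w} u φ P e s refl = src-reached , tgt-unreached
      where
      X = toSet G (P ++ [ e ])
      φe : Feasible G r X
      φe = subst (λ L → Feasible G r (toSet G L)) (take-suc-length P e s) (φ (suc (length P)))
      e∈X : e ∈ X
      e∈X = ∈-toSet⁺ (∈-++⁺ʳ P (here refl))
      in-P : ∀ {f} → f ∈ X → f ≢ e → f L.∈ P
      in-P {f} f∈ f≢e with ∈-++⁻ P (∈-toSet⁻ (P ++ [ e ]) f∈)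
      ... | inj₁ f∈P         = f∈P
      ... | inj₂ (here f≡e) = contradiction f≡e f≢e
      src-reached : Reached P (src G e)
      src-reached with src G e ≟ r
      ... | yes s≡r = inj₁ s≡r
      ... | no s≢r with reach⇒last-edge (proj₁ (proj₁ φe e e∈X)) (λ r≡s → s≢r (sym r≡s))
      ...   | f , f∈ , t≡ , _ = inj₂ (L.lose (in-P f∈ λ { refl → feasible-no-loop φe e∈X (sym t≡) }) t≡)
      tgt-unreached : ¬ Reached P (tgt G e)
      tgt-unreached (inj₁ t≡r) = feasible-tgt≢root φe e∈X t≡r
      tgt-unreached (inj₂ hit) with L.find hit
      ... | f , f∈P , t≡ =
        Unique-middle P u (subst (L._∈ P) (feasible-tgt-injective φe (∈-toSet⁺ (∈-++⁺ˡ f∈P)) e∈X t≡) f∈P)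

    feasibleWord⇒growing : ∀ {X} → FeasibleWord G r X w → Growing w
    feasibleWord⇒growing (u , _ , φ) = prefixes-feasible⇒growing u φ

    growing⇒feasibleWord : ∀ {X} → Growing w → (∀ e → e ∈ X ⇔ e L.∈ w) → FeasibleWord G r X w
    growing⇒feasibleWord γ X⇔w = growing⇒unique γ , X⇔w , growing⇒prefixes-feasible γ

    -- Greedy and lexicographically minimal words

    Available : Subset (m G) → List (E G) → E G → Set
    Available X L x = x ∈ X × ¬ x L.∈ L × Reached L (src G x)

    available? : ∀ X L x → Dec (Available X L x)
    available? X L x = (x ∈? X) ×-dec ¬? (Any.any? (x ≟_) L) ×-dec reached? L (src G x)

    Greedy-after : Subset (m G) → List (E G) → List (E G) → Set
    Greedy-after X L w = ∀ Q y s → w ≡ L ++ Q ++ y ∷ s → ∀ {x} → Available X (L ++ Q) x → y ≤ᶠ x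

    Greedy : Subset (m G) → List (E G) → Set
    Greedy X = Greedy-after X []

    greedy-after-[] : ∀ {X} L → Greedy-after X L (L ++ [])
    greedy-after-[] L Q y s eq = ⊥-elim ([]≢++∷ Q (++-cancelˡ L [] (Q ++ y ∷ s) eq))

    greedy-after-∷ : ∀ {X} L {x s} → (∀ {x′} → Available X L x′ → x ≤ᶠ x′) →
                     Greedy-after X (L ++ [ x ]) ((L ++ [ x ]) ++ s) → Greedy-after X L (L ++ x ∷ s)
    greedy-after-∷ {X} L least greedy []      y s′ eq ax with ∷-injective (++-cancelˡ L _ _ eq)
    ... | refl , _ = least (subst (λ P → Available X P _) (++-identityʳ L) ax)
    greedy-after-∷ {X} L {x} {s} least greedy (q ∷ Q) y s′ eq ax with ∷-injective (++-cancelˡ L _ _ eq)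
    ... | refl , s≡ =
      greedy Q y s′ (trans (++-assoc L [ x ] s)
                           (trans (cong (λ t → L ++ x ∷ t) s≡) (sym (++-assoc L [ x ] (Q ++ y ∷ s′)))))
                    (subst (λ P → Available X P _) (sym (++-assoc L [ x ] Q)) ax)

    greedy⇒lexMin : ∀ {X w} → FeasibleWord G r X w → Greedy X w → LexMinWord G r X w
    greedy⇒lexMin {X} {w} ωw greedy = ωw , compare
      where
      compare : ∀ z → FeasibleWord G r X z → w ≡ z ⊎ _<lex_ G w z
      compare z ωz with firstDifference _≟_ w z
      ... | equal w≡z   = inj₁ w≡z
      ... | extends z≡  = inj₂ (<lex-extends z≡)
      ... | extended {x} {s} refl =
        ⊥-elim (growing-∉-prefix z s (feasibleWord⇒growing ωw)
                  (Equivalence.to (proj₁ (proj₂ ωz) x)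
                                  (Equivalence.from (proj₁ (proj₂ ωw) x) (∈-++⁺ʳ z (here refl)))))
      ... | differ P {x} {y} {s} {s′} x≢y w≡ refl =
        inj₂ (<lex-at P (Fin.≤∧≢⇒< (greedy P x s w≡ y-available) x≢y) w≡ refl)
        where
        γz = feasibleWord⇒growing ωz
        y-available : Available X P y
        y-available = Equivalence.from (proj₁ (proj₂ ωz) y) (∈-++⁺ʳ P (here refl)) ,
                      growing-∉-prefix P s′ γz , proj₁ (γz P y s′ refl)

    lexMin-unique : ∀ {X w w′} → LexMinWord G r X w → LexMinWord G r X w′ → w ≡ w′
    lexMin-unique (ωw , min) (ωw′ , min′) with min _ ωw′ | min′ _ ωw
    ... | inj₁ w≡w′ | _          = w≡w′
    ... | inj₂ _    | inj₁ w′≡w  = sym w′≡w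
    ... | inj₂ lt   | inj₂ lt′   = ⊥-elim (<lex-asym lt lt′)

    ⊆-snoc : ∀ {X : Subset (m G)} {L x} → (∀ {y} → y L.∈ L → y ∈ X) → x ∈ X → ∀ {y} → y L.∈ L ++ [ x ] → y ∈ X
    ⊆-snoc {L = L} L⊆X x∈ y∈ with ∈-++⁻ L y∈
    ... | inj₁ y∈L         = L⊆X y∈L
    ... | inj₂ (here refl) = x∈

    module _ {X : Subset (m G)} (fX : Feasible G r X) where

      growing-snoc-available : Growing L → (∀ {x} → x L.∈ L → x ∈ X) →
                               ∀ {x} → Available X L x → Growing (L ++ [ x ])
      growing-snoc-available {L} γ L⊆X (x∈ , x∉ , ρ) = growing-snoc L γ ρ unreached
        where
        unreached : ¬ Reached L (tgt G _)
        unreached (inj₁ t≡r) = feasible-tgt≢root fX x∈ t≡r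
        unreached (inj₂ hit) with L.find hit
        ... | f , f∈ , t≡ = x∉ (subst (L._∈ L) (feasible-tgt-injective fX (L⊆X f∈) x∈ t≡) f∈)

      -- The first edge outside L on a path from r to src e inside X is available.
      available-exists : ∀ L {e} → e ∈ X → ¬ e L.∈ L → Σ (E G) (Available X L)
      available-exists L {e} e∈ e∉ = along (proj₁ (proj₁ fX e e∈)) (inj₁ refl)
        where
        along : ∀ {a} → Reach G X a (src G e) → Reached L a → Σ (E G) (Available X L)
        along here              ρ = e , e∈ , e∉ , ρ
        along (step f f∈ s≡ ρ′) ρ with Any.any? (f ≟_) L
        ... | no f∉  = f , f∈ , f∉ , subst (Reached L) (sym s≡) ρ
        ... | yes f∈L = along ρ′ (reached-tgt f∈L)

      private
        Remaining : List (E G) → E G → Set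
        Remaining L e = e ∈ X × ¬ e L.∈ L

        remaining? : ∀ L e → Dec (Remaining L e)
        remaining? L e = (e ∈? X) ×-dec ¬? (Any.any? (e ≟_) L)

        #remaining : List (E G) → ℕ
        #remaining L = count (remaining? L) (allFin (m G))

        #remaining-snoc : ∀ L {x} → x ∈ X → ¬ x L.∈ L → #remaining (L ++ [ x ]) < #remaining L
        #remaining-snoc L {x} x∈ x∉ =
          count-< (remaining? (L ++ [ x ])) (remaining? L) (λ (e∈ , e∉) → e∈ , λ e∈L → e∉ (∈-++⁺ˡ e∈L))
                  (∈-allFin x) (x∈ , x∉) (λ (_ , x∉′) → x∉′ (∈-++⁺ʳ L (here refl)))

      -- Repeatedly append the least available edge.
      greedy-completion : ∀ L → Growing L → (∀ {x} → x L.∈ L → x ∈ X) →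
                          Σ (List (E G)) λ s → FeasibleWord G r X (L ++ s) × Greedy-after X L (L ++ s)
      greedy-completion L = go L (<-wellFounded (#remaining L))
        where
        go : ∀ L → Acc _<_ (#remaining L) → Growing L → (∀ {x} → x L.∈ L → x ∈ X) →
             Σ (List (E G)) λ s → FeasibleWord G r X (L ++ s) × Greedy-after X L (L ++ s)
        go L (acc rec) γ L⊆X with least (available? X L)
        ... | inj₂ none =
          [] , subst (FeasibleWord G r X) (sym (++-identityʳ L)) (growing⇒feasibleWord γ (λ e → mk⇔ X⊆L L⊆X)) ,
          greedy-after-[] L
          where
          X⊆L : ∀ {e} → e ∈ X → e L.∈ L
          X⊆L {e} e∈ with Any.any? (e ≟_) L
          ... | yes e∈L = e∈L
          ... | no e∉L  = ⊥-elim (none _ (proj₂ (available-exists L e∈ e∉L)))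
        ... | inj₁ (x , ax@(x∈ , x∉ , _) , least-x)
          with go (L ++ [ x ]) (rec (#remaining-snoc L x∈ x∉)) (growing-snoc-available γ L⊆X ax) (⊆-snoc L⊆X x∈)
        ...   | s , ω , greedy = x ∷ s , subst (FeasibleWord G r X) (++-assoc L [ x ] s) ω , greedy-after-∷ L least-x greedy

      lexMin-exists : Σ (List (E G)) (LexMinWord G r X)
      lexMin-exists with greedy-completion [] growing-[] (λ ())
      ... | w , ωw , greedy = w , greedy⇒lexMin ωw greedy

      -- If an available edge x were smaller than the next letter y, greedily completing P ++ [ x ]
      -- would give a lexicographically smaller feasible word.
      lexMin⇒greedy : ∀ {w} → LexMinWord G r X w → Greedy X w
      lexMin⇒greedy {w} (ωw , min) P y s refl {x} ax@(x∈ , _ , _) with x Fin.<? y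
      ... | no x≮y  = ≮⇒≥ x≮y
      ... | yes x<y = ⊥-elim (not-smaller (min _ (proj₁ (proj₂ completion))) smaller)
        where
        P⊆X : ∀ {z} → z L.∈ P → z ∈ X
        P⊆X z∈ = Equivalence.from (proj₁ (proj₂ ωw) _) (∈-++⁺ˡ z∈)
        completion = greedy-completion (P ++ [ x ])
                       (growing-snoc-available (growing-prefix P (y ∷ s) (feasibleWord⇒growing ωw)) P⊆X ax) (⊆-snoc P⊆X x∈)
        smaller : _<lex_ G ((P ++ [ x ]) ++ proj₁ completion) (P ++ y ∷ s)
        smaller = <lex-at P x<y (++-assoc P [ x ] _) refl
        not-smaller : ∀ {u} → P ++ y ∷ s ≡ u ⊎ _<lex_ G (P ++ y ∷ s) u → ¬ _<lex_ G u (P ++ y ∷ s)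
        not-smaller (inj₁ refl) = <lex-irrefl
        not-smaller (inj₂ lt)   = <lex-asym lt

    -- Bases: backward edges are externally active

    module _ {B : Subset (m G)} (bB : IsBasis G r B) {w} (μw : LexMinWord G r B w) where

      private
        fB = proj₁ bB
        B⇔w = proj₁ (proj₂ (proj₁ μw))
        γw = feasibleWord⇒growing (proj₁ μw)

      basis-increasing : ∀ {e} → e ∈ B → time w (src G e) < time w (tgt G e)
      basis-increasing e∈ = growing-increasing γw (Equivalence.to (B⇔w _) e∈)

      reach⇒reached : ∀ {v} → Reach G B r v → Reached w v
      reach⇒reached {v} ρ with v ≟ r
      ... | yes v≡r = inj₁ v≡r
      ... | no v≢r with reach⇒last-edge ρ (λ r≡v → v≢r (sym r≡v))
      ...   | f , f∈ , t≡ , _ = subst (Reached w) t≡ (reached-tgt (Equivalence.to (B⇔w f) f∈))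

      reached⇒reach : ∀ {v} → Reached w v → Reach G B r v
      reached⇒reach ρ = reach-mono (λ e∈ → Equivalence.from (B⇔w _) (∈-toSet⁻ w e∈)) (growing-reach γw ρ)

      -- An edge from the tree to an unreached vertex could be added to B, contradicting maximality.
      no-edge-leaves : ∀ {e} → Reach G B r (src G e) → ¬ Reached w (tgt G e) → ⊥
      no-edge-leaves {e} ρ ¬ρt = ¬ρt (reach⇒reached (proj₂ (proj₁ fB e (e∈B (x∈p∪q⁺ (inj₂ (x∈⁅x⁆ e)))))))
        where
        B⁺ = B ∪ ⁅ e ⁆
        B⊆B⁺ : B ⊆ B⁺
        B⊆B⁺ = p⊆p∪q ⁅ e ⁆
        in-B⁺ : ∀ {y} → y ∈ B⁺ → y ∈ B ⊎ y ≡ e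
        in-B⁺ y∈ with x∈p∪q⁻ B ⁅ e ⁆ y∈
        ... | inj₁ y∈B = inj₁ y∈B
        ... | inj₂ y≡e = inj₂ (x∈⁅y⁆⇒x≡y e y≡e)
        ρ⁺ : Reach G B⁺ r (src G e)
        ρ⁺ = reach-mono B⊆B⁺ ρ
        reachable : ∀ y → y ∈ B⁺ → Reach G B⁺ r (src G y) × Reach G B⁺ r (tgt G y)
        reachable y y∈ with in-B⁺ y∈
        ... | inj₁ y∈B  = let ρs , ρt = proj₁ fB y y∈B in reach-mono B⊆B⁺ ρs , reach-mono B⊆B⁺ ρt
        ... | inj₂ refl = ρ⁺ , reach-snoc ρ⁺ y∈
        increasing : ∀ {y} → y ∈ B⁺ → time w (src G y) < time w (tgt G y)
        increasing y∈ with in-B⁺ y∈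
        ... | inj₁ y∈B  = basis-increasing y∈B
        ... | inj₂ refl = subst (λ u → time u (src G e) < time u (tgt G e)) (++-identityʳ w)
                            (time-increases w [] (reach⇒reached ρ) ¬ρt)
        enters-reached : ∀ {b} → b ∈ B → tgt G b ≢ tgt G e
        enters-reached b∈ t≡ = ¬ρt (subst (Reached w) t≡ (reached-tgt (Equivalence.to (B⇔w _) b∈)))
        injective : ∀ {y₁ y₂} → y₁ ∈ B⁺ → y₂ ∈ B⁺ → tgt G y₁ ≡ tgt G y₂ → y₁ ≡ y₂
        injective y₁∈ y₂∈ t≡ with in-B⁺ y₁∈ | in-B⁺ y₂∈
        ... | inj₁ b₁   | inj₁ b₂   = feasible-tgt-injective fB b₁ b₂ t≡
        ... | inj₁ b₁   | inj₂ refl = ⊥-elim (enters-reached b₁ t≡)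
        ... | inj₂ refl | inj₁ b₂   = ⊥-elim (enters-reached b₂ (sym t≡))
        ... | inj₂ refl | inj₂ refl = refl
        e∈B : e ∈ B⁺ → e ∈ B
        e∈B = proj₂ bB B⁺ (reachable , no-ucycle-by-potential (time w) increasing injective) B⊆B⁺

      basis-spanning : RootConnected G ⊤ r → ∀ v → Reach G B r v
      basis-spanning rc v = along (rc v) here
        where
        along : ∀ {a b} → Reach G ⊤ a b → Reach G B r a → Reach G B r b
        along here             ρ = ρ
        along (step e _ refl σ) ρ with reached? w (tgt G e)
        ... | yes ρt = along σ (reached⇒reach ρt)
        ... | no ¬ρt = ⊥-elim (no-edge-leaves ρ ¬ρt)

      basis-Backward-isConnFAS : RootConnected G ⊤ r → IsConnFAS G r (Backward (time w))
      basis-Backward-isConnFAS rc = Backward-isConnFAS (time w) entered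
        where
        entered : ∀ v → v ≢ r → Σ (E G) λ e → tgt G e ≡ v × time w (src G e) < time w v
        entered v v≢r with reach⇒last-edge (basis-spanning rc v) (λ r≡v → v≢r (sym r≡v))
        ... | e , e∈ , refl , _ = e , refl , basis-increasing e∈

      Backward⇒time-≤ : ∀ {e} → e ∈ Backward (time w) → time w (tgt G e) ≤ time w (src G e)
      Backward⇒time-≤ = ∈-subset⁻ (λ e → time w (tgt G e) ≤? time w (src G e))

      Backward⇒∉ : ∀ {e} → e ∈ Backward (time w) → e ∉ B
      Backward⇒∉ e∈ e∈B = <⇒≱ (basis-increasing e∈B) (Backward⇒time-≤ e∈)

      -- Where the lexicographically minimal words of B and of B - f ∪ {e} first differ, the latter
      -- cannot use e (its target is already reached there), and any other letter of it is available
      -- to the greedy word w, hence larger.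
      Backward-exchange-larger : ∀ {e f w₂} → e ∈ Backward (time w) → LexMinWord G r ((B - f) ∪ ⁅ e ⁆) w₂ →
                                 _<lex_ G w w₂
      Backward-exchange-larger {e} {f} {w₂} e∈ μ₂ = larger (firstDifference _≟_ w w₂)
        where
        B′⇔w₂ = proj₁ (proj₂ (proj₁ μ₂))
        γ₂ = feasibleWord⇒growing (proj₁ μ₂)
        e∉w : ¬ e L.∈ w
        e∉w e∈w = Backward⇒∉ e∈ (Equivalence.from (B⇔w e) e∈w)
        e∈w₂ : e L.∈ w₂
        e∈w₂ = Equivalence.to (B′⇔w₂ e) (x∈p∪q⁺ (inj₂ (x∈⁅x⁆ e)))
        larger : FirstDifference w w₂ → _<lex_ G w w₂
        larger (equal w≡w₂)  = ⊥-elim (e∉w (subst (e L.∈_) (sym w≡w₂) e∈w₂))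
        larger (extends w₂≡) = <lex-extends w₂≡
        larger (extended w≡) = ⊥-elim (e∉w (subst (e L.∈_) (sym w≡) (∈-++⁺ˡ e∈w₂)))
        larger (differ P {x} {y} {s} {s′} x≢y w≡ w₂≡) with y ≟ e
        ... | yes refl = ⊥-elim (proj₂ (γ₂ P e s′ w₂≡) tgt-reached)
          where
          tgt-reached : Reached P (tgt G e)
          tgt-reached = time-≤⇒reached P (x ∷ s) (subst (λ u → time u (tgt G e) ≤ length P) w≡
                          (≤-trans (Backward⇒time-≤ e∈) (subst (λ u → time u (src G e) ≤ length P) (sym w≡)
                            (time-≤ P (x ∷ s) (proj₁ (γ₂ P e s′ w₂≡))))))
        ... | no y≢e   = <lex-at P (Fin.≤∧≢⇒< x≤y x≢y) w≡ w₂≡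
          where
          y∈B : y ∈ B
          y∈B with x∈p∪q⁻ (B - f) ⁅ e ⁆
                     (Equivalence.from (B′⇔w₂ y) (subst (y L.∈_) (sym w₂≡) (∈-++⁺ʳ P (here refl))))
          ... | inj₁ y∈B-f = p─q⊆p B ⁅ f ⁆ y∈B-f
          ... | inj₂ y≡e   = contradiction (x∈⁅y⁆⇒x≡y e y≡e) y≢e
          γP = subst Growing w₂≡ γ₂
          x≤y : x ≤ᶠ y
          x≤y = lexMin⇒greedy fB μw P x s w≡ (y∈B , growing-∉-prefix P s′ γP , proj₁ (γP P y s′ refl))

      Backward⇒externallyActive : ∀ {e} → e ∈ Backward (time w) → ExtActive G r B e
      Backward⇒externallyActive e∈ = Backward⇒∉ e∈ , λ f _ _ w₁ w₂ μ₁ μ₂ →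
        subst (λ u → _<lex_ G u w₂) (sym (lexMin-unique μ₁ μw)) (Backward-exchange-larger e∈ μ₂)

    module _ {B : Subset (m G)} (bB : IsBasis G r B) where

      minFAS≤activity : RootConnected G ⊤ r → ∀ {j k} → ExtActivity G r B j → MinFAS G r k → k ≤ j
      minFAS≤activity rc (A , A⇔active , ∣A∣≡j) (_ , minimal) with lexMin-exists (proj₁ bB)
      ... | w , μw = ≤-trans (minimal _ (basis-Backward-isConnFAS bB μw rc))
                             (subst (∣ Backward (time w) ∣ ≤_) ∣A∣≡j
                                    (p⊆q⇒∣p∣≤∣q∣ (λ e∈ → Equivalence.from (A⇔active _) (Backward⇒externallyActive bB μw e∈))))

    -- Parking functions

    module _ {F : Subset (m G)} (cF : IsConnFAS G r F) where

      private
        indeg : V G → ℕ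
        indeg = inDegree (_∈? ∁ F)

      fasParking : V G → ℕ
      fasParking v = indeg v ∸ 1

      private
        indeg-root : indeg r ≡ 0
        indeg-root = count-none (λ e → (e ∈? ∁ F) ×-dec (tgt G e ≟ r))
                                (λ e (e∈ , t≡r) → connFAS-root-unentered cF e∈ t≡r) (allFin (m G))

        indeg-pos : ∀ {v} → v ≢ r → 0 < indeg v
        indeg-pos {v} v≢r with reach⇒last-edge (proj₁ cF v) (λ r≡v → v≢r (sym r≡v))
        ... | e , e∈ , t≡ , _ = count-pos (λ e → (e ∈? ∁ F) ×-dec (tgt G e ≟ v)) (∈-allFin e) (e∈ , t≡)

      fasParking-isParking : IsParking G r fasParking
      fasParking-isParking = cong (_∸ 1) indeg-root , parking
        where
        parking : ∀ S → Nonempty S → r ∉ S → Σ (V G) λ u → u ∈ S × fasParking u < dIn G S u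
        parking S (v , v∈) r∉ with acyclic⇒source (proj₂ cF) (_∈? S) v∈
        ... | u , u∈ , no-pred = u , u∈ , <-≤-trans (∸-monoʳ-< (s≤s z≤n) (indeg-pos u≢r)) entering-from-outside
          where
          u≢r : u ≢ r
          u≢r refl = r∉ u∈
          entering-from-outside : indeg u ≤ dIn G S u
          entering-from-outside = count-mono _ _ (λ (e∈ , t≡) → (λ s∈ → no-pred (_ , e∈ , t≡ , s∈)) , t≡) (allFin (m G))

      fasParking-weight : weight G fasParking + n G ≡ (m G ∸ ∣ F ∣) + 1
      fasParking-weight = begin
        weight G fasParking + n G                                     ≡⟨ weight+n fasParking ⟩
        ∑ (allFin (n G)) (λ v → fasParking v + 1)                     ≡⟨ ∑-cong (allFin (n G)) pointwise ⟩
        ∑ (allFin (n G)) (λ v → indeg v + indicator (r ≟ v))         ≡⟨ ∑-+ (allFin (n G)) indeg _ ⟩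
        ∑ (allFin (n G)) indeg + ∑ (allFin (n G)) (λ v → indicator (r ≟ v))
                                                                      ≡⟨ cong₂ _+_ (trans (∑-inDegree _) (sym (∣p∣≡count (∁ F)))) (∑-indicator-≟ r) ⟩
        ∣ ∁ F ∣ + 1                                                   ≡⟨ cong (_+ 1) (∣∁p∣≡n∸∣p∣ F) ⟩
        (m G ∸ ∣ F ∣) + 1 ∎
        where
        open ≡-Reasoning
        pointwise : ∀ v → fasParking v + 1 ≡ indeg v + indicator (r ≟ v)
        pointwise v with r ≟ v
        ... | yes refl = trans (cong (λ d → d ∸ 1 + 1) indeg-root) (cong (_+ 1) (sym indeg-root))
        ... | no r≢v   = trans (m∸n+n≡m (indeg-pos (λ v≡r → r≢v (sym v≡r)))) (sym (+-identityʳ _))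

    module _ {p : V G → ℕ} (park : IsParking G r p) where

      Burning : Subset (n G) → Set
      Burning S = Σ (V G → ℕ) λ t → (∀ {v} → v ∈ S → t v ≡ 0) × (∀ {v} → v ∉ S → p v < inDegree (forward? t) v)

      #unburnt : Subset (n G) → ℕ
      #unburnt S = count (λ v → ¬? (v ∈? S)) (allFin (n G))

      #unburnt-∪ : ∀ S {u} → u ∉ S → #unburnt (S ∪ ⁅ u ⁆) < #unburnt S
      #unburnt-∪ S {u} u∉ = count-< _ _ (λ v∉S′ v∈S → v∉S′ (x∈p∪q⁺ (inj₁ v∈S))) (∈-allFin u) u∉
                                    (λ u∉S′ → u∉S′ (x∈p∪q⁺ (inj₂ (x∈⁅x⁆ u))))

      module _ (S : Subset (n G)) (t : V G → ℕ) where

        raise : V G → ℕ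
        raise v = if does (v ∈? S) then 0 else suc (t v)

        raise-∈ : ∀ {v} → v ∈ S → raise v ≡ 0
        raise-∈ {v} v∈ with v ∈? S
        ... | yes _ = refl
        ... | no v∉ = contradiction v∈ v∉

        raise-< : ∀ {a b} → b ∉ S → a ∈ S ⊎ t a < t b → raise a < raise b
        raise-< {a} {b} b∉ ord with a ∈? S | b ∈? S | ord
        ... | _     | yes b∈ | _        = contradiction b∈ b∉
        ... | yes _ | no _   | _        = s≤s z≤n
        ... | no a∉ | no _   | inj₁ a∈ = contradiction a∈ a∉
        ... | no _  | no _   | inj₂ lt  = s≤s lt

      -- Burn u and lift the unburnt vertices one level above the burnt set S.
      burning-step : ∀ S {u} → u ∉ S → p u < dIn G (∁ S) u → Burning (S ∪ ⁅ u ⁆) → Burning S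
      burning-step S {u} u∉ p<d (t , _ , t-burns) = raise S t , raise-∈ S t , raise-burns
        where
        into : ∀ {v a b} → v ∉ S → b ≡ v → a ∈ S ⊎ t a < t b → raise S t a < raise S t b
        into v∉ refl = raise-< S t v∉
        raise-burns : ∀ {v} → v ∉ S → p v < inDegree (forward? (raise S t)) v
        raise-burns {v} v∉ with v ≟ u
        ... | yes refl = <-≤-trans p<d
                           (count-mono _ _ (λ (s∉ , t≡) → into v∉ t≡ (inj₁ (x∉∁p⇒x∈p s∉)) , t≡) (allFin (m G)))
        ... | no v≢u   = <-≤-trans (t-burns v∉S′)
                           (count-mono _ _ (λ (lt , t≡) → into v∉ t≡ (inj₂ lt) , t≡) (allFin (m G)))
          where
          v∉S′ : v ∉ S ∪ ⁅ u ⁆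
          v∉S′ v∈ with x∈p∪q⁻ S ⁅ u ⁆ v∈
          ... | inj₁ v∈S = v∉ v∈S
          ... | inj₂ v≡u = v≢u (x∈⁅y⁆⇒x≡y u v≡u)

      -- Dhar's burning algorithm: the parking condition for V - S provides the next vertex to burn.
      burning : ∀ S → r ∈ S → Burning S
      burning S = go S (<-wellFounded (#unburnt S))
        where
        go : ∀ S → Acc _<_ (#unburnt S) → r ∈ S → Burning S
        go S (acc rec) r∈ with Fin.any? (λ v → ¬? (v ∈? S))
        ... | no all-burnt = (λ _ → 0) , (λ _ → refl) , λ {v} v∉ → ⊥-elim (all-burnt (v , v∉))
        ... | yes (v₀ , v₀∉) with proj₂ park (∁ S) (v₀ , x∉p⇒x∈∁p v₀∉) (x∈p⇒x∉∁p r∈)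
        ...   | u , u∈∁S , p<d = burning-step S u∉ p<d (go (S ∪ ⁅ u ⁆) (rec (#unburnt-∪ S u∉)) (x∈p∪q⁺ (inj₁ r∈)))
          where
          u∉ = x∈∁p⇒x∉p u∈∁S

      parking-weight-bound : ∀ {k} → MinFAS G r k → weight G p + n G ≤ (m G ∸ k) + 1
      parking-weight-bound {k} (_ , minimal) with burning ⁅ r ⁆ (x∈⁅x⁆ r)
      ... | t , t-root , t-burns = begin
        weight G p + n G                                                   ≡⟨ weight+n p ⟩
        ∑ (allFin (n G)) (λ v → p v + 1)                                   ≤⟨ ∑-mono (allFin (n G)) pointwise ⟩
        ∑ (allFin (n G)) (λ v → inDegree (forward? t) v + indicator (r ≟ v)) ≡⟨ ∑-+ (allFin (n G)) _ _ ⟩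
        ∑ (allFin (n G)) (inDegree (forward? t)) + ∑ (allFin (n G)) (λ v → indicator (r ≟ v))
                                                                           ≡⟨ cong₂ _+_ (∑-inDegree (forward? t)) (∑-indicator-≟ r) ⟩
        count (forward? t) (allFin (m G)) + 1                              ≡⟨ cong (_+ 1) #forward ⟩
        (m G ∸ ∣ Backward t ∣) + 1                                       ≤⟨ +-monoˡ-≤ 1 (∸-monoʳ-≤ (m G) k≤∣Backward∣) ⟩
        (m G ∸ k) + 1 ∎
        where
        open ≤-Reasoning
        ∉root : ∀ {v} → v ≢ r → v ∉ ⁅ r ⁆
        ∉root v≢r v∈ = v≢r (x∈⁅y⁆⇒x≡y r v∈)
        entered : ∀ v → v ≢ r → Σ (E G) λ e → tgt G e ≡ v × t (src G e) < t v
        entered v v≢r with count-witness _ (allFin (m G)) (≤-<-trans z≤n (t-burns (∉root v≢r)))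
        ... | e , lt , refl = e , refl , lt
        k≤∣Backward∣ : k ≤ ∣ Backward t ∣
        k≤∣Backward∣ = minimal _ (Backward-isConnFAS t entered)
        pointwise : ∀ v → p v + 1 ≤ inDegree (forward? t) v + indicator (r ≟ v)
        pointwise v with r ≟ v
        ... | yes refl = subst (λ x → x + 1 ≤ _) (sym (proj₁ park)) (m≤n+m 1 _)
        ... | no r≢v   = subst₂ _≤_ (+-comm 1 (p v)) (sym (+-identityʳ _)) (t-burns (∉root (λ v≡r → r≢v (sym v≡r))))
        #forward : count (forward? t) (allFin (m G)) ≡ m G ∸ ∣ Backward t ∣
        #forward = trans (count-cong _ (_∈? ∁ (Backward t)) (<⇒∉-Backward t) (∉-Backward⇒< t) (allFin (m G)))
                         (trans (sym (∣p∣≡count (∁ (Backward t)))) (∣∁p∣≡n∸∣p∣ (Backward t)))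

    parkingDegree : ∀ {k} → MinFAS G r k → ParkingDegree G r (m G + 1 ∸ n G ∸ k)
    parkingDegree {k} μ@((F , cF , refl) , _) =
      (fasParking cF , fasParking-isParking cF , weight-≡) , λ p park → weight-≤ p (parking-weight-bound park μ)
      where
      shift : (m G ∸ ∣ F ∣) + 1 ∸ n G ≡ m G + 1 ∸ n G ∸ ∣ F ∣
      shift = [m∸k]+1∸n≡m+1∸n∸k (m G) (n G) (∣p∣≤n F)
      weight-≡ : weight G (fasParking cF) ≡ m G + 1 ∸ n G ∸ ∣ F ∣
      weight-≡ = trans (sym (m+n∸n≡m _ (n G))) (trans (cong (_∸ n G) (fasParking-weight cF)) shift)
      weight-≤ : ∀ p → weight G p + n G ≤ (m G ∸ ∣ F ∣) + 1 → weight G p ≤ m G + 1 ∸ n G ∸ ∣ F ∣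
      weight-≤ p le = subst₂ _≤_ (m+n∸n≡m _ (n G)) shift (∸-monoˡ-≤ (n G) le)

    -- A basis with exactly minfas externally active edges

    -- EligibleAfter P s e: each letter of s appended once src e was reached (by P and the letters
    -- before it) is smaller than e.
    EligibleAfter : List (E G) → List (E G) → E G → Set
    EligibleAfter P []      e = Unit
    EligibleAfter P (y ∷ s) e = (Reached P (src G e) → y <ᶠ e) × EligibleAfter (P ++ [ y ]) s e

    eligibleAfter? : ∀ P s e → Dec (EligibleAfter P s e)
    eligibleAfter? P []      e = yes tt
    eligibleAfter? P (y ∷ s) e = (reached? P (src G e) →-dec (y Fin.<? e)) ×-dec eligibleAfter? (P ++ [ y ]) s e

    Eligible : List (E G) → E G → Set
    Eligible = EligibleAfter []

    private
      reached-≡ : ∀ {P Q v} → P ≡ Q → Reached P v → Reached Q v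
      reached-≡ refl ρ = ρ

    eligibleAfter-at : ∀ {e} P Q {y s} → EligibleAfter P (Q ++ y ∷ s) e → Reached (P ++ Q) (src G e) → y <ᶠ e
    eligibleAfter-at P []      (lt , _) ρ = lt (reached-≡ (++-identityʳ P) ρ)
    eligibleAfter-at P (q ∷ Q) (_ , el) ρ = eligibleAfter-at (P ++ [ q ]) Q el (reached-≡ (sym (++-assoc P [ q ] Q)) ρ)

    eligibleAfter-snoc : ∀ {e} P s {x} → EligibleAfter P s e → (Reached (P ++ s) (src G e) → x <ᶠ e) →
                         EligibleAfter P (s ++ [ x ]) e
    eligibleAfter-snoc P []      _          lt = (λ ρ → lt (reached-≡ (sym (++-identityʳ P)) ρ)) , tt
    eligibleAfter-snoc P (y ∷ s) (lt′ , el) lt =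
      lt′ , eligibleAfter-snoc (P ++ [ y ]) s el (λ ρ → lt (reached-≡ (++-assoc P [ y ] s) ρ))

    eligibleAfter-unreached : ∀ {e} P s → ¬ Reached (P ++ s) (src G e) → EligibleAfter P s e
    eligibleAfter-unreached P []      _  = tt
    eligibleAfter-unreached P (y ∷ s) ¬ρ =
      (λ ρ → ⊥-elim (¬ρ (reached-++ (y ∷ s) ρ))) ,
      eligibleAfter-unreached (P ++ [ y ]) s (λ ρ → ¬ρ (reached-≡ (++-assoc P [ y ] s) ρ))

    Violation : List (E G) → List (E G) → E G → Set
    Violation P s e = Σ (List (E G)) λ Q → Σ (E G) λ y → Σ (List (E G)) λ s′ →
                      s ≡ Q ++ y ∷ s′ × Reached (P ++ Q) (src G e) × ¬ y <ᶠ e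

    violation-∷ : ∀ {e} P {y s} → Violation (P ++ [ y ]) s e → Violation P (y ∷ s) e
    violation-∷ P {y} (Q , z , s′ , s≡ , ρ , z≮e) = y ∷ Q , z , s′ , cong (y ∷_) s≡ , reached-≡ (++-assoc P [ y ] Q) ρ , z≮e

    ¬eligibleAfter⇒violation : ∀ {e} P s → ¬ EligibleAfter P s e → Violation P s e
    ¬eligibleAfter⇒violation P []      ¬el = ⊥-elim (¬el tt)
    ¬eligibleAfter⇒violation {e} P (y ∷ s) ¬el with reached? P (src G e) | y Fin.<? e
    ... | yes ρ | no y≮e  = [] , y , s , refl , reached-≡ (sym (++-identityʳ P)) ρ , y≮e
    ... | yes _ | yes y<e = violation-∷ P (¬eligibleAfter⇒violation (P ++ [ y ]) s (λ el → ¬el ((λ _ → y<e) , el)))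
    ... | no ¬ρ | _       =
      violation-∷ P (¬eligibleAfter⇒violation (P ++ [ y ]) s (λ el → ¬el ((λ ρ → contradiction ρ ¬ρ) , el)))

    module _ {F : Subset (m G)} (cF : IsConnFAS G r F) where

      private
        D = ∁ F

      Ready : List (E G) → V G → Set
      Ready L v = ¬ Reached L v × (∀ e → e ∈ D → tgt G e ≡ v → Reached L (src G e))

      ready? : ∀ L v → Dec (Ready L v)
      ready? L v = ¬? (reached? L v) ×-dec Fin.all? (λ e → (e ∈? D) →-dec ((tgt G e ≟ v) →-dec reached? L (src G e)))

      MaximalEligible : List (E G) → E G → Set
      MaximalEligible L x = ∀ e → e ∈ D → tgt G e ≡ tgt G x → Eligible L e → e ≤ᶠ x

      maximalEligible? : ∀ L x → Dec (MaximalEligible L x)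
      maximalEligible? L x =
        Fin.all? (λ e → (e ∈? D) →-dec ((tgt G e ≟ tgt G x) →-dec (eligibleAfter? [] L e →-dec (e Fin.≤? x))))

      -- The edges that may be appended next; the construction always appends the least one.
      Candidate : List (E G) → E G → Set
      Candidate L x = x ∈ D × Ready L (tgt G x) × Eligible L x × MaximalEligible L x

      candidate? : ∀ L x → Dec (Candidate L x)
      candidate? L x = (x ∈? D) ×-dec ready? L (tgt G x) ×-dec eligibleAfter? [] L x ×-dec maximalEligible? L x

      LeastCandidate : List (E G) → E G → Set
      LeastCandidate L x = Candidate L x × ∀ {y} → Candidate L y → x ≤ᶠ y

      Invariant : List (E G) → Set
      Invariant L = ∀ v → Ready L v → Σ (E G) λ e → e ∈ D × tgt G e ≡ v × Eligible L e

      Chosen : List (E G) → Set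
      Chosen w = ∀ P x s → w ≡ P ++ x ∷ s → LeastCandidate P x

      candidate-into : ∀ L v → Ready L v → Invariant L → Σ (E G) λ c → Candidate L c × tgt G c ≡ v
      candidate-into L v ready inv with greatest (λ e → (e ∈? D) ×-dec (tgt G e ≟ v) ×-dec eligibleAfter? [] L e)
      ... | inj₂ none = ⊥-elim (none _ (proj₂ (inv v ready)))
      ... | inj₁ (c , (c∈ , c→ , c-el) , c-max) =
        c , (c∈ , subst (Ready L) (sym c→) ready , c-el , λ e e∈ e→ e-el → c-max (e∈ , trans e→ c→ , e-el)) , c→

      invariant-[] : Invariant []
      invariant-[] v (¬ρ , _) with reach⇒last-edge (proj₁ cF v) (λ r≡v → ¬ρ (inj₁ (sym r≡v)))
      ... | e , e∈ , e→ , _ = e , e∈ , e→ , tt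

      ready-if-no-late-edge : ∀ L {v} → ¬ Reached L v →
                              ¬ (Σ (E G) λ e → e ∈ D × tgt G e ≡ v × ¬ Reached L (src G e)) → Ready L v
      ready-if-no-late-edge L ¬ρ none =
        ¬ρ , λ e e∈ e→ → decidable-stable (reached? L (src G e)) (λ ¬ρs → none (e , e∈ , e→ , ¬ρs))

      -- An edge into v with a still unreached source is vacuously eligible; otherwise v was already
      -- ready, and its candidate c, larger than the least candidate x, stays eligible.
      invariant-snoc : ∀ L {x} → Invariant L → LeastCandidate L x → Invariant (L ++ [ x ])
      invariant-snoc L {x} inv (_ , least-x) v (¬ρ′ , _)
        with Fin.any? (λ e → (e ∈? D) ×-dec (tgt G e ≟ v) ×-dec ¬? (reached? L (src G e)))
      ... | yes (e , e∈ , e→ , ¬ρs) =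
        e , e∈ , e→ , eligibleAfter-snoc [] L (eligibleAfter-unreached [] L ¬ρs) (λ ρs → ⊥-elim (¬ρs ρs))
      ... | no none with candidate-into L v (ready-if-no-late-edge L (λ ρ → ¬ρ′ (reached-++ [ x ] ρ)) none) inv
      ...   | c , cc , c→ = c , proj₁ cc , c→ , eligibleAfter-snoc [] L (proj₁ (proj₂ (proj₂ cc))) (λ _ → x<c)
        where
        x≢c : x ≢ c
        x≢c refl = ¬ρ′ (subst (Reached (L ++ [ x ])) c→ (reached-tgt (∈-++⁺ʳ L (here refl))))
        x<c : x <ᶠ c
        x<c = Fin.≤∧≢⇒< (least-x cc) x≢c

      chosen-snoc : ∀ L {x} → Chosen L → LeastCandidate L x → Chosen (L ++ [ x ])
      chosen-snoc L chosen least P y s eq with snoc-split L _ P y s eq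
      ... | inj₁ (refl , refl , refl) = least
      ... | inj₂ (s₀ , L≡ , _)        = chosen P y s₀ L≡

      #unreached : List (E G) → ℕ
      #unreached L = count (λ v → ¬? (reached? L v)) (allFin (n G))

      #unreached-snoc : ∀ L {x} → Candidate L x → #unreached (L ++ [ x ]) < #unreached L
      #unreached-snoc L {x} (_ , (¬ρ , _) , _) =
        count-< _ _ (λ ¬ρ′ ρ → ¬ρ′ (reached-++ [ x ] ρ)) (∈-allFin (tgt G x)) ¬ρ
                (λ ¬ρ′ → ¬ρ′ (reached-tgt (∈-++⁺ʳ L (here refl))))

      -- Append the least candidate while some vertex is unreached; an unreached vertex whose
      -- D-predecessors are all reached exists since D is acyclic.
      construction : Σ (List (E G)) λ w → Chosen w × (∀ v → Reached w v)
      construction = go [] (<-wellFounded (#unreached [])) invariant-[] (λ P _ _ eq → ⊥-elim ([]≢++∷ P eq))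
        where
        go : ∀ L → Acc _<_ (#unreached L) → Invariant L → Chosen L → Σ (List (E G)) λ w → Chosen w × (∀ v → Reached w v)
        go L (acc rec) inv chosen with Fin.any? (λ v → ¬? (reached? L v))
        ... | no none = L , chosen , λ v → decidable-stable (reached? L v) (λ ¬ρ → none (v , ¬ρ))
        ... | yes (_ , ¬ρ₀) with acyclic⇒source (proj₂ cF) (λ v → ¬? (reached? L v)) ¬ρ₀
        ...   | u , ¬ρu , no-pred with candidate-into L u (ready-if-no-late-edge L ¬ρu no-pred) inv
        ...     | c , cc , _ with least (candidate? L)
        ...       | inj₂ none = ⊥-elim (none c cc)
        ...       | inj₁ (x , cx , least-x) =
          go (L ++ [ x ]) (rec (#unreached-snoc L cx)) (invariant-snoc L inv (cx , least-x)) (chosen-snoc L chosen (cx , least-x))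

      chosen⇒growing : ∀ {w} → Chosen w → Growing w
      chosen⇒growing chosen P x s eq with proj₁ (chosen P x s eq)
      ... | x∈D , (¬ρ , in-reached) , _ = in-reached x x∈D refl , ¬ρ

      private
        w₀ = proj₁ construction
        chosen = proj₁ (proj₂ construction)
        all-reached = proj₂ (proj₂ construction)
        γ = chosen⇒growing chosen
        B = toSet G w₀
        B⇔w : ∀ e → e ∈ B ⇔ e L.∈ w₀
        B⇔w e = mk⇔ (∈-toSet⁻ w₀) (∈-toSet⁺)
        τ = time w₀

      -- An available edge of B is appended later, and was eligible at that point.
      construction-greedy : Greedy B w₀
      construction-greedy P y s eq {x} (x∈ , x∉ , ρ) with ∈-++⁻ P (subst (x L.∈_) eq (∈-toSet⁻ w₀ x∈))
      ... | inj₁ x∈P         = contradiction x∈P x∉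
      ... | inj₂ (here refl) = Fin.≤-refl
      ... | inj₂ (there x∈s) with ∈-∃++ x∈s
      ...   | s₁ , s₂ , refl = <⇒≤ (eligibleAfter-at [] P eligible ρ)
        where
        eligible = proj₁ (proj₂ (proj₂ (proj₁ (chosen (P ++ y ∷ s₁) x s₂ (trans eq (sym (++-assoc P (y ∷ s₁) (x ∷ s₂))))))))

      construction-lexMin : LexMinWord G r B w₀
      construction-lexMin = greedy⇒lexMin (growing⇒feasibleWord γ B⇔w) construction-greedy

      construction-basis : IsBasis G r B
      construction-basis = growing⇒feasible γ , maximal
        where
        maximal : ∀ X → Feasible G r X → B ⊆ X → X ⊆ B
        maximal X fX B⊆X {y} y∈ with all-reached (tgt G y)
        ... | inj₁ t≡r = ⊥-elim (feasible-tgt≢root fX y∈ t≡r)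
        ... | inj₂ hit with L.find hit
        ...   | x , x∈w , t≡ = subst (_∈ B) (feasible-tgt-injective fX (B⊆X (∈-toSet⁺ x∈w)) y∈ t≡) (∈-toSet⁺ x∈w)

      entering-edge : ∀ {e} → e ∈ D → Σ (List (E G)) λ P → Σ (E G) λ x → Σ (List (E G)) λ s →
                      w₀ ≡ P ++ x ∷ s × tgt G x ≡ tgt G e × LeastCandidate P x × Reached P (src G e)
      entering-edge {e} e∈ with all-reached (tgt G e)
      ... | inj₁ t≡r = ⊥-elim (connFAS-root-unentered cF e∈ t≡r)
      ... | inj₂ hit with L.find hit
      ...   | x , x∈w , t≡ with ∈-∃++ x∈w
      ...     | P , s , w≡ = let cx , least-x = chosen P x s w≡; _ , (_ , in-reached) , _ = cx in
                             P , x , s , w≡ , t≡ , (cx , least-x) , in-reached e e∈ (sym t≡)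

      D-increasing : ∀ {e} → e ∈ D → τ (src G e) < τ (tgt G e)
      D-increasing {e} e∈ with entering-edge e∈
      ... | P , x , s , w≡ , t≡ , (cx , _) , ρs =
        subst (λ u → time u (src G e) < time u (tgt G e)) (sym w≡)
              (time-increases P (x ∷ s) ρs (subst (λ v → ¬ Reached P v) t≡ (proj₁ (proj₁ (proj₂ cx)))))

      Backward⊆F : Backward τ ⊆ F
      Backward⊆F {e} e∈ with e ∈? F
      ... | yes e∈F = e∈F
      ... | no e∉F  = ⊥-elim (<⇒≱ (D-increasing (x∉p⇒x∈∁p e∉F)) (∈-subset⁻ (λ e → τ (tgt G e) ≤? τ (src G e)) e∈))

      -- An edge e ∈ D outside B is not externally active: exchanging it for the edge x of B entering
      -- tgt e gives a feasible set with a feasible word smaller than w₀.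
      module _ {e} (e∈D : e ∈ D) (e∉B : e ∉ B) {P x s} (w≡ : w₀ ≡ P ++ x ∷ s) (x→ : tgt G x ≡ tgt G e)
               (cx : Candidate P x) (ρs : Reached P (src G e)) where

        private
          in-w : ∀ {y} P′ {s′} → w₀ ≡ P′ ++ y ∷ s′ → y L.∈ w₀
          in-w P′ w≡′ = subst (_ L.∈_) (sym w≡′) (∈-++⁺ʳ P′ (here refl))
          x∈w = in-w P w≡
          e≢ : ∀ {y} → y L.∈ w₀ → e ≢ y
          e≢ y∈w refl = e∉B (∈-toSet⁺ y∈w)

        B′ = (B - x) ∪ ⁅ e ⁆

        ∈-B′⁻ : ∀ {y} → y ∈ B′ → (y ∈ B × y ≢ x) ⊎ y ≡ e
        ∈-B′⁻ y∈ with x∈p∪q⁻ (B - x) ⁅ e ⁆ y∈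
        ... | inj₁ y∈B-x = inj₁ (p─q⊆p B ⁅ x ⁆ y∈B-x , x∈p-y⇒x≢y y∈B-x)
        ... | inj₂ y≡e   = inj₂ (x∈⁅y⁆⇒x≡y e y≡e)

        ∈-B′⁺ : ∀ {y} → y ∈ B → y ≢ x → y ∈ B′
        ∈-B′⁺ y∈ y≢x = x∈p∪q⁺ (inj₁ (x∈p∧x≢y⇒x∈p-y y∈ y≢x))

        e∈B′ : e ∈ B′
        e∈B′ = x∈p∪q⁺ (inj₂ (x∈⁅x⁆ e))

        B′-feasible : Feasible G r B′
        B′-feasible = potential⇒feasible τ increasing injective entered
          where
          increasing : ∀ {y} → y ∈ B′ → τ (src G y) < τ (tgt G y)
          increasing y∈ with ∈-B′⁻ y∈
          ... | inj₁ (y∈B , _) = growing-increasing γ (∈-toSet⁻ w₀ y∈B)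
          ... | inj₂ refl      = D-increasing e∈D
          into-tgt-e : ∀ {b} → b ∈ B → tgt G b ≡ tgt G e → b ≡ x
          into-tgt-e b∈ t≡ = growing-tgt-injective γ (∈-toSet⁻ w₀ b∈) x∈w (trans t≡ (sym x→))
          injective : ∀ {y₁ y₂} → y₁ ∈ B′ → y₂ ∈ B′ → tgt G y₁ ≡ tgt G y₂ → y₁ ≡ y₂
          injective y₁∈ y₂∈ t≡ with ∈-B′⁻ y₁∈ | ∈-B′⁻ y₂∈
          ... | inj₁ (b₁ , _)   | inj₁ (b₂ , _)   = growing-tgt-injective γ (∈-toSet⁻ w₀ b₁) (∈-toSet⁻ w₀ b₂) t≡
          ... | inj₁ (b₁ , b₁≢x) | inj₂ refl       = ⊥-elim (b₁≢x (into-tgt-e b₁ t≡))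
          ... | inj₂ refl       | inj₁ (b₂ , b₂≢x) = ⊥-elim (b₂≢x (into-tgt-e b₂ (sym t≡)))
          ... | inj₂ refl       | inj₂ refl       = refl
          entered : ∀ v → v ≢ r → Σ (E G) λ y → y ∈ B′ × tgt G y ≡ v
          entered v v≢r with v ≟ tgt G e | all-reached v
          ... | yes refl | _          = e , e∈B′ , refl
          ... | no _     | inj₁ v≡r   = contradiction v≡r v≢r
          ... | no v≢te  | inj₂ hit with L.find hit
          ...   | b , b∈w , refl = b , ∈-B′⁺ (∈-toSet⁺ b∈w) (λ { refl → v≢te x→ }) , refl

        -- A prefix P′ of w₀, followed by a letter y > e, after which e can be appended instead.
        Cut : Set
        Cut = Σ (List (E G)) λ P′ → Σ (E G) λ y → Σ (List (E G)) λ s′ →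
              w₀ ≡ P′ ++ y ∷ s′ × (∀ {z} → z L.∈ P′ → z L.∈ P) × Reached P′ (src G e) × e <ᶠ y

        cut : Cut
        cut with eligibleAfter? [] P e
        ... | yes el = let _ , _ , _ , x-maximal = cx in
                       P , x , s , w≡ , (λ z∈ → z∈) , ρs , Fin.≤∧≢⇒< (x-maximal e e∈D (sym x→) el) (e≢ x∈w)
        ... | no ¬el with ¬eligibleAfter⇒violation [] P ¬el
        ...   | Q , y , s′ , refl , ρQ , y≮e =
          Q , y , s′ ++ x ∷ s , w≡′ , ∈-++⁺ˡ , ρQ , Fin.≤∧≢⇒< (≮⇒≥ y≮e) (e≢ (in-w Q w≡′))
          where
          w≡′ : w₀ ≡ Q ++ y ∷ s′ ++ x ∷ s
          w≡′ = trans w≡ (++-assoc Q (y ∷ s′) (x ∷ s))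

        cut-extendable : ∀ {P′ y s′} → w₀ ≡ P′ ++ y ∷ s′ → (∀ {z} → z L.∈ P′ → z L.∈ P) → Reached P′ (src G e) →
                         Growing (P′ ++ [ e ]) × (∀ {z} → z L.∈ P′ ++ [ e ] → z ∈ B′)
        cut-extendable {P′} {y} {s′} w≡′ P′⊆P ρ′ =
          growing-snoc-available B′-feasible (growing-prefix P′ (y ∷ s′) (subst Growing w≡′ γ)) P′⊆B′
                                 (e∈B′ , e∉P′ , ρ′) ,
          ⊆-snoc P′⊆B′ e∈B′
          where
          P′⊆B′ : ∀ {z} → z L.∈ P′ → z ∈ B′
          P′⊆B′ z∈ = ∈-B′⁺ (∈-toSet⁺ (subst (_ L.∈_) (sym w≡) (∈-++⁺ˡ (P′⊆P z∈))))
                            (λ { refl → growing-∉-prefix P s (subst Growing w≡ γ) (P′⊆P z∈) })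
          e∉P′ : ¬ e L.∈ P′
          e∉P′ e∈P′ = e∉B (∈-toSet⁺ (subst (_ L.∈_) (sym w≡′) (∈-++⁺ˡ e∈P′)))

        cheaper : Σ (List (E G)) λ z → FeasibleWord G r B′ z × _<lex_ G z w₀
        cheaper with cut
        ... | P′ , y , s′ , w≡′ , P′⊆P , ρ′ , e<y with cut-extendable w≡′ P′⊆P ρ′
        ...   | γ′ , ⊆B′ with greedy-completion B′-feasible (P′ ++ [ e ]) γ′ ⊆B′
        ...     | t , ωt , _ = (P′ ++ [ e ]) ++ t , ωt , <lex-at P′ e<y (++-assoc P′ [ e ] t) w≡′

        not-active : ¬ ExtActive G r B e
        not-active (_ , active) with cheaper | lexMin-exists B′-feasible
        ... | z , ωz , z<w | w₂ , μ₂ = not-below (proj₂ μ₂ z ωz)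
          where
          w<w₂ = active x (∈-toSet⁺ x∈w) B′-feasible w₀ w₂ construction-lexMin μ₂
          not-below : w₂ ≡ z ⊎ _<lex_ G w₂ z → ⊥
          not-below (inj₁ refl) = <lex-asym w<w₂ z<w
          not-below (inj₂ w₂<z) = <lex-irrefl (<lex-trans w<w₂ (<lex-trans w₂<z z<w))

      outside-F-and-B-inactive : ∀ {e} → e ∈ D → e ∉ B → ¬ ExtActive G r B e
      outside-F-and-B-inactive e∈D e∉B with entering-edge e∈D
      ... | P , x , s , w≡ , x→ , (cx , _) , ρs = not-active e∈D e∉B w≡ x→ cx ρs

      module _ (rc : RootConnected G ⊤ r) {k} (∣F∣≡k : ∣ F ∣ ≡ k) (minimal : ∀ F′ → IsConnFAS G r F′ → k ≤ ∣ F′ ∣) where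

        private
          Backward-connFAS : IsConnFAS G r (Backward τ)
          Backward-connFAS = basis-Backward-isConnFAS construction-basis construction-lexMin rc

        -- By minimality of F, the backward edges of τ are exactly F.
        ∣Backward∣≡k : ∣ Backward τ ∣ ≡ k
        ∣Backward∣≡k = ≤-antisym (subst (∣ Backward τ ∣ ≤_) ∣F∣≡k (p⊆q⇒∣p∣≤∣q∣ Backward⊆F)) (minimal _ Backward-connFAS)

        externallyActive⇒Backward : ∀ {e} → ExtActive G r B e → e ∈ Backward τ
        externallyActive⇒Backward {e} active with e ∈? Backward τ
        ... | yes e∈ = e∈
        ... | no e∉ with e ∈? F
        ...   | yes e∈F = ⊥-elim (<⇒≱ (subst (∣ Backward τ ∣ <_) ∣F∣≡k (p⊂q⇒∣p∣<∣q∣ (Backward⊆F , e , e∈F , e∉)))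
                                     (minimal _ Backward-connFAS))
        ...   | no e∉F  = ⊥-elim (outside-F-and-B-inactive (x∉p⇒x∈∁p e∉F) (proj₁ active) active)

        greedoidCoeff-minFAS : GreedoidCoeffNonzero G r k
        greedoidCoeff-minFAS = B , construction-basis , Backward τ ,
          (λ e → mk⇔ (Backward⇒externallyActive construction-basis construction-lexMin) externallyActive⇒Backward) ,
          ∣Backward∣≡k

theorem1p11 : (G : Digraph) (r : Fin (n G)) → RootConnected G ⊤ r →
    (k : ℕ) → MinFAS G r k →
      ParkingDegree G r (m G + 1 ∸ n G ∸ k)
      × ((j : ℕ) → j < k → ¬ GreedoidCoeffNonzero G r j)
      × GreedoidCoeffNonzero G r k
theorem1p11 G r rc k μ@((F , cF , ∣F∣≡k) , minimal) =
  parkingDegree G r μ ,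
  (λ j j<k (B , bB , activity) → <⇒≱ j<k (minFAS≤activity G r bB rc activity μ)) ,
  greedoidCoeff-minFAS G r cF rc ∣F∣≡k minimal
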